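{- Let $(G,T)\in\mathcal{P}(r,A)$ and let $(H,\emptyset)$ be a graft with $V(G)\cap V(H)=\emptyset$. Then for any set $S$ of edges between $A$ and $V(H)$, the pair $(G+H+S,T)$ is a graft having a connected minimum join that covers $r$.
   Context: Graphs are finite (loops/parallel edges allowed); $G+H+S$ denotes the graph with vertex set $V(G)\cup V(H)$ and edge set $E(G)\cup E(H)\cup S$. A graft is a pair $(G,T)$, $T\subseteq V(G)$, each component of $G$ containing an even number of vertices of $T$. A join is $F\subseteq E(G)$ with $|\delta_G(v)\cap F|$ odd for $v\in T$, even for $v\notin T$; minimum = minimum cardinality; connected if the subgraph formed by its edges is connected (empty set not connected); covers $v$ if an edge of $F$ is incident to $v$. $N_G(X)$ is the set of vertices outside $X$ adjacent to $X$. Rake: $(G,T)$ is a rake with tooth set $B$ and head $r$ if $B\subseteq T$ is stable, $N_G(B)=V(G)\setminus B$, $r\in V(G)\setminus B$ is adjacent to every vertex of $B$, and $T=B\cup\{r\}$ if $|B|$ odd, $T=B$ if $|B|$ even; $\mathcal{R}(r,B)$ is the class of such rakes. Gluing sum: let $(G_0,T_0)$ be a connected graft, $S'\subseteq T_0$ a nonempty stable set, $e_s\in\delta_{G_0}(s)$ for $s\in S'$; let $(G_s,T_s)$, $s\in S'$, be mutually disjoint grafts disjoint from $G_0$, with $A_s\subseteq V(G_s)$, $r_s\in A_s$, and maps $f_s:\delta_{G_0}(s)\to A_s$ with $f_s(e_s)=r_s$. The gluing sum is $(G',T')$ with $V(G')=(V(G_0)\setminus S')\cup\bigcup_sV(G_s)$,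 $E(G')=(E(G_0)\setminus\delta_{G_0}(S'))\cup\bigcup_sE(G_s)\cup\bigcup_s\{xf_s(xs):x\in V(G_0)\setminus S', xs\in\delta_{G_0}(s)\}$, $T'=(T_0\setminus S')\cup\bigcup_s(T_s\Delta\{r_s\})$. $\mathcal{P}(r,A)$ is defined inductively: (a) every $(G,T)\in\mathcal{R}(r,B)$ lies in $\mathcal{P}(r,V(G)\setminus B)$; (b) if $(G,T)\in\mathcal{R}(r,B)$ and $(H_b,T_b)\in\mathcal{P}(r_b,A_b)$ ($b\in B$) are mutually disjoint and disjoint from $G$, every gluing sum with $(G_0,T_0)=(G,T)$, $S'=B$, $e_b=rb$, and the grafts $(H_b,T_b)$ with $A_b,r_b$, lies in $\mathcal{P}(r,V(G)\setminus B)$. -}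

module Defs where

open import Data.Nat using (ℕ; zero; suc; _+_; _≤_; _≡ᵇ_)
open import Data.Nat.Divisibility using (_∣_)
open import Data.Bool using (Bool; true; false; if_then_else_; not; _xor_; _∧_)
open import Data.Fin using (Fin; zero; suc)
open import Data.List using (List; []; _∷_; _++_; map; concatMap; length; lookup; allFin; filterᵇ)
open import Data.Bool.ListAction using (any)
open import Data.List.Membership.Propositional using (_∈_; _∉_)
open import Data.List.Relation.Unary.Unique.Propositional using (Unique)
open import Data.Product using (Σ; ∃; _×_; _,_; proj₁; proj₂)
open import Data.Sum using (_⊎_)
open import Data.Empty using (⊥)
open import Relation.Nullary using (¬_)
open import Relation.Binary.PropositionalEquality using (_≡_; _≢_)
open import Function using (_∘_)
open import Function.Bundles using (_⇔_; _↔_; Inverse)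

-- Vertices are natural-number labels; an edge is an (unordered) pair of
-- endpoints, stored as an ordered pair; edges are identified by their
-- position in the edge list (so parallel edges are distinct edges).

Edge : Set
Edge = ℕ × ℕ

record Graph : Set where
  constructor graph
  field
    V : List ℕ
    E : List Edge
open Graph public

WF : Graph → Set
WF G = Unique (V G) × (∀ e → e ∈ E G → proj₁ e ∈ V G × proj₂ e ∈ V G)

EIdx : Graph → Set
EIdx G = Fin (length (E G))

edge : (G : Graph) → EIdx G → Edge
edge G i = lookup (E G) i

EdgeEq : Edge → Edge → Set
EdgeEq (a , b) (c , d) = (a ≡ c × b ≡ d) ⊎ (a ≡ d × b ≡ c)

Ends : ℕ → Edge → Set
Ends v (a , b) = (v ≡ a) ⊎ (v ≡ b)

Adj : Graph → ℕ → ℕ → Set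
Adj G u v = Σ (EIdx G) λ i → EdgeEq (edge G i) (u , v)

Disjoint : List ℕ → List ℕ → Set
Disjoint xs ys = ∀ x → x ∈ xs → x ∈ ys → ⊥

_⊕_⊕_ : Graph → Graph → List Edge → Graph
G ⊕ H ⊕ S = graph (V G ++ V H) (E G ++ E H ++ S)

Even : ℕ → Set
Even n = 2 ∣ n

Odd : ℕ → Set
Odd n = ¬ (2 ∣ n)

count : ∀ {n} → (Fin n → Bool) → ℕ
count {zero} p = 0
count {suc n} p = (if p zero then 1 else 0) + count (λ i → p (suc i))

EdgeSet : Graph → Set
EdgeSet G = EIdx G → Bool

-- δ(v) : edges with exactly one endpoint equal to v (cut convention;
-- loops are not in δ(v))
inCutᵇ : ℕ → Edge → Bool
inCutᵇ v (a , b) = (a ≡ᵇ v) xor (b ≡ᵇ v)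

deg : (G : Graph) → EdgeSet G → ℕ → ℕ
deg G F v = count (λ i → F i ∧ inCutᵇ v (edge G i))

data Reach (G : Graph) (F : EdgeSet G) : ℕ → ℕ → Set where
  here : ∀ {u} → Reach G F u u
  step : ∀ {u x w} (i : EIdx G) → F i ≡ true → EdgeEq (edge G i) (u , x) →
         Reach G F x w → Reach G F u w

allEdges : (G : Graph) → EdgeSet G
allEdges G i = true

-- The component of v is {x | x reachable from v};
-- L lists (without repetition) exactly the T-vertices of that component.
IsGraft : Graph → List ℕ → Set
IsGraft G T =
  WF G × (∀ t → t ∈ T → t ∈ V G) ×
  (∀ v → v ∈ V G → (L : List ℕ) → Unique L →
     (∀ x → x ∈ L ⇔ (x ∈ T × Reach G (allEdges G) v x)) →
     Even (length L))

IsJoin : (G : Graph) → List ℕ → EdgeSet G → Set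
IsJoin G T F = ∀ v → v ∈ V G →
  (v ∈ T → Odd (deg G F v)) × (v ∉ T → Even (deg G F v))

IsMinJoin : (G : Graph) → List ℕ → EdgeSet G → Set
IsMinJoin G T F = IsJoin G T F × (∀ F′ → IsJoin G T F′ → count F ≤ count F′)

Covers : (G : Graph) → EdgeSet G → ℕ → Set
Covers G F v = Σ (EIdx G) λ i → F i ≡ true × Ends v (edge G i)

IsConnected : (G : Graph) → EdgeSet G → Set
IsConnected G F = (Σ (EIdx G) λ i → F i ≡ true) ×
  (∀ u w → Covers G F u → Covers G F w → Reach G F u w)

Stable : Graph → List ℕ → Set
Stable G B = ∀ i → ¬ (proj₁ (edge G i) ∈ B × proj₂ (edge G i) ∈ B)

record IsRake (G : Graph) (T : List ℕ) (r : ℕ) (B : List ℕ) : Set where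
  field
    wf        : WF G
    B-unique  : Unique B
    B⊆V       : ∀ b → b ∈ B → b ∈ V G
    B⊆T       : ∀ b → b ∈ B → b ∈ T
    B-stable  : Stable G B
    -- N_G(B) = V(G) ∖ B  (N_G(B) ⊆ V(G) ∖ B holds by definition of N_G)
    N-B       : ∀ v → v ∈ V G → v ∉ B → Σ ℕ λ b → b ∈ B × Adj G v b
    r∈V       : r ∈ V G
    r∉B       : r ∉ B
    r-adj     : ∀ b → b ∈ B → Adj G r b
    T-odd     : Odd (length B) → ∀ x → x ∈ T ⇔ (x ∈ B ⊎ x ≡ r)
    T-even    : Even (length B) → ∀ x → x ∈ T ⇔ x ∈ B

-- Gluing sum along the tooth set B of a rake G0 (S' = B), with glued
-- graphs H b (b ∈ B) and the maps f_b : δ(b) → A_b combined into a single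
-- map f on edge indices of G0 (the sets δ(b), b ∈ B, are disjoint since B
-- is stable; only the values on δ(B) matter).

memᵇ : ℕ → List ℕ → Bool
memᵇ x xs = any (λ y → y ≡ᵇ x) xs

cutBᵇ : List ℕ → Edge → Bool
cutBᵇ B (a , b) = memᵇ a B xor memᵇ b B

outer : List ℕ → Edge → ℕ
outer B (a , b) = if memᵇ a B then b else a

-- E(G') = (E(G0) ∖ δ(B)) ∪ ⋃_b E(H_b) ∪ { x f(xb) : xb ∈ δ(B) }
glueEdges : (G0 : Graph) → List ℕ → (ℕ → Graph) → (EIdx G0 → ℕ) → List Edge
glueEdges G0 B H f =
  map (edge G0) (filterᵇ (λ i → not (cutBᵇ B (edge G0 i))) (allFin _))
  ++ concatMap (λ b → E (H b)) B
  ++ map (λ i → (outer B (edge G0 i) , f i))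
         (filterᵇ (λ i → cutBᵇ B (edge G0 i)) (allFin _))

SameEdges : List Edge → List Edge → Set
SameEdges E₁ E₂ = Σ (Fin (length E₁) ↔ Fin (length E₂)) λ π →
  ∀ i → EdgeEq (lookup E₁ i) (lookup E₂ (Inverse.to π i))

data P : ℕ → List ℕ → Graph → List ℕ → Set where
  rake : ∀ {G T r B A} → IsRake G T r B →
         (∀ x → x ∈ A ⇔ (x ∈ V G × x ∉ B)) →
         P r A G T
  glue : ∀ {G0 T0 r B A} → IsRake G0 T0 r B →
         (∀ x → x ∈ A ⇔ (x ∈ V G0 × x ∉ B)) →
         (H : ℕ → Graph) (TH AH : ℕ → List ℕ) (rH : ℕ → ℕ) →
         (∀ b → b ∈ B → P (rH b) (AH b) (H b) (TH b)) →
         (∀ b → b ∈ B → Disjoint (V (H b)) (V G0)) →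
         (∀ b c → b ∈ B → c ∈ B → b ≢ c → Disjoint (V (H b)) (V (H c))) →
         (f : EIdx G0 → ℕ) →
         (∀ i b → b ∈ B → inCutᵇ b (edge G0 i) ≡ true → f i ∈ AH b) →
         (∀ b → b ∈ B → Σ (EIdx G0) λ i → EdgeEq (edge G0 i) (r , b) × f i ≡ rH b) →
         (G′ : Graph) (T′ : List ℕ) → WF G′ →
         (∀ x → x ∈ V G′ ⇔ ((x ∈ V G0 × x ∉ B) ⊎ Σ ℕ λ b → b ∈ B × x ∈ V (H b))) →
         SameEdges (E G′) (glueEdges G0 B H f) →
         (∀ x → x ∈ T′ ⇔ ((x ∈ T0 × x ∉ B) ⊎
            Σ ℕ λ b → b ∈ B × ((x ∈ TH b × x ≢ rH b) ⊎ (x ∉ TH b × x ≡ rH b)))) →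
         P r A G′ T′

-- Every (G, T) ∈ 𝒫(r, A) carries a rooted join: a join F of (G, T) that covers r and whose edges
-- all lie in the component of r, together with a minimality certificate that survives attaching
-- new edges at A: every list N of admissible edges whose parity agrees with T at all vertices of G
-- other than r has at least |F| edges touching V(G) ∖ A.
-- For a rake, F is the star from r to the teeth B = V(G) ∖ A: each tooth needs an edge of N, and
-- no admissible edge meets two teeth. For a gluing sum, F is the union of the rooted joins F_b of
-- the glued parts and the edges r r_b; parity forces an edge of N leaving V(H_b), which meets V(H_b)
-- only in A_b and so comes on top of the |F_b| edges certified for H_b.
-- In G + H + S the set F is still a join, as H carries no vertex of T, it is minimal by the
-- certificate, and every vertex of T reaches r, so a component contains either no vertex of T
-- or all of them.

module Submission where

open import Defs
open import Algebra.Bundles using (CommutativeRing)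
open import Data.Nat using (ℕ; zero; suc; _+_; _*_; _≤_; _≟_; _≡ᵇ_; s≤s; z≤n)
open import Data.Nat.Properties
  using (+-assoc; +-identityʳ; +-suc; +-mono-≤; ≤-trans; n≤1+n; ≡ᵇ⇒≡;
         +-commutativeSemigroup; +-0-commutativeMonoid; module ≤-Reasoning)
open import Data.Nat.Divisibility using (divides)
open import Data.Bool using (Bool; true; false; not; _∧_; _∨_; _xor_; if_then_else_)
open import Data.Bool.Properties
  using (not-involutive; not-distribˡ-xor; xor-comm; xor-identityʳ;
         ∧-zeroʳ; ∧-identityʳ; ∨-zeroʳ; ∨-identityʳ; ∨-comm; T-≡; xor-∧-commutativeRing)
open import Data.Fin using (Fin; zero; suc)
open import Data.List using (List; []; _∷_; _++_; map; concatMap; filterᵇ; allFin; length; lookup; tabulate)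
open import Data.List.Properties using (length-++)
open import Data.List.Membership.Propositional.Properties using (∈-lookup; ∈-++⁺ˡ; ∈-++⁺ʳ; ∈-++⁻; ∈-allFin; ∈-map⁺; ∈-map⁻; ∈-filter⁺; ∈-filter⁻; ∈-concatMap⁻)
open import Data.List.Relation.Binary.Sublist.Propositional using (_⊆_; []; _∷_; _∷ʳ_)
import Data.List.Relation.Binary.Sublist.Propositional.Properties as Sublist
open import Data.List.Membership.Propositional using (_∈_; _∉_; find)
open import Data.List.Membership.DecPropositional _≟_ using (_∈?_)
open import Data.List.Relation.Unary.Any using (here; there)
import Data.List.Relation.Unary.Any as Any
open import Data.List.Relation.Unary.Any.Properties using (lookup-index)
open import Data.List.Relation.Unary.All using (All; []; _∷_)
import Data.List.Relation.Unary.All as All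
open import Data.List.Relation.Unary.All.Properties using (All¬⇒¬Any)
open import Data.List.Relation.Unary.AllPairs using ([]; _∷_)
open import Data.List.Relation.Unary.Unique.Propositional using (Unique)
import Data.List.Relation.Unary.Unique.Propositional.Properties as Unique
open import Data.Product using (Σ; _×_; _,_; proj₁; proj₂)
open import Data.Sum using (_⊎_; inj₁; inj₂; [_,_]′)
open import Data.Empty using (⊥-elim)
open import Relation.Nullary using (¬_; yes; no)
open import Relation.Nullary.Decidable using (T?)
open import Relation.Binary.PropositionalEquality using (_≡_; _≢_; refl; sym; trans; cong; cong₂; subst; module ≡-Reasoning)
open import Function using (_∘_)
open import Function.Bundles using (Equivalence; Inverse; _↔_; _⇔_; mk⇔)
open import Algebra.Properties.CommutativeSemigroup +-commutativeSemigroup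
  using () renaming (interchange to +-interchange; x∙yz≈y∙xz to +-left-comm)
open import Algebra.Properties.CommutativeSemigroup
  (CommutativeRing.+-commutativeSemigroup xor-∧-commutativeRing)
  using () renaming (interchange to xor-interchange)
open import Algebra.Properties.CommutativeMonoid.Sum +-0-commutativeMonoid using (sum; sum-permute)

⟦_⟧ : Bool → ℕ
⟦ b ⟧ = if b then 1 else 0

sumF : {X : Set} → (X → ℕ) → List X → ℕ
sumF f [] = 0
sumF f (x ∷ xs) = f x + sumF f xs

countL : {X : Set} → (X → Bool) → List X → ℕ
countL p = sumF (λ x → ⟦ p x ⟧)

module _ {X : Set} where

  sumF-++ : (f : X → ℕ) (xs ys : List X) → sumF f (xs ++ ys) ≡ sumF f xs + sumF f ys
  sumF-++ f [] ys = refl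
  sumF-++ f (x ∷ xs) ys = trans (cong (f x +_) (sumF-++ f xs ys)) (sym (+-assoc (f x) _ _))

  sumF-cong : {f g : X → ℕ} (xs : List X) → (∀ x → x ∈ xs → f x ≡ g x) → sumF f xs ≡ sumF g xs
  sumF-cong [] h = refl
  sumF-cong (x ∷ xs) h = cong₂ _+_ (h x (here refl)) (sumF-cong xs (λ y y∈ → h y (there y∈)))

  sumF-mono : {f g : X → ℕ} (xs : List X) → (∀ x → x ∈ xs → f x ≤ g x) → sumF f xs ≤ sumF g xs
  sumF-mono [] h = z≤n
  sumF-mono (x ∷ xs) h = +-mono-≤ (h x (here refl)) (sumF-mono xs (λ y y∈ → h y (there y∈)))

  sumF-+ : (f g : X → ℕ) (xs : List X) → sumF (λ x → f x + g x) xs ≡ sumF f xs + sumF g xs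
  sumF-+ f g [] = refl
  sumF-+ f g (x ∷ xs) = trans (cong (f x + g x +_) (sumF-+ f g xs)) (+-interchange (f x) (g x) _ _)

  sumF-zero : (f : X → ℕ) (xs : List X) → (∀ x → x ∈ xs → f x ≡ 0) → sumF f xs ≡ 0
  sumF-zero f [] h = refl
  sumF-zero f (x ∷ xs) h rewrite h x (here refl) = sumF-zero f xs (λ y y∈ → h y (there y∈))

  sumF-single : (f : X → ℕ) (xs : List X) → Unique xs → ∀ {b} → b ∈ xs →
    (∀ c → c ∈ xs → c ≢ b → f c ≡ 0) → sumF f xs ≡ f b
  sumF-single f (x ∷ xs) (x∉ ∷ u) (here refl) h =
    trans (cong (f x +_) (sumF-zero f xs (λ c c∈ → h c (there c∈) (λ { refl → All¬⇒¬Any x∉ c∈ }))))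
          (+-identityʳ _)
  sumF-single f (x ∷ xs) (x∉ ∷ u) (there b∈) h =
    trans (cong (_+ sumF f xs) (h x (here refl) (λ { refl → All¬⇒¬Any x∉ b∈ })))
          (sumF-single f xs u b∈ (λ c c∈ → h c (there c∈)))

  countL-zero : (p : X → Bool) (xs : List X) → (∀ x → x ∈ xs → p x ≡ false) → countL p xs ≡ 0
  countL-zero p xs h = sumF-zero _ xs (λ x x∈ → cong ⟦_⟧ (h x x∈))

  countL-pos : (p : X → Bool) (xs : List X) → 1 ≤ countL p xs → Σ X λ x → x ∈ xs × p x ≡ true
  countL-pos p (x ∷ xs) h with p x in eq
  ... | true = x , here refl , eq
  ... | false with countL-pos p xs h
  ... | y , y∈ , py = y , there y∈ , py

  countL≤length : (p : X → Bool) (xs : List X) → countL p xs ≤ length xs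
  countL≤length p [] = z≤n
  countL≤length p (x ∷ xs) with p x
  ... | true = s≤s (countL≤length p xs)
  ... | false = ≤-trans (countL≤length p xs) (n≤1+n _)

  length≡countL-true : (xs : List X) → length xs ≡ countL (λ _ → true) xs
  length≡countL-true [] = refl
  length≡countL-true (x ∷ xs) = cong suc (length≡countL-true xs)

  countL-filterᵇ : (p g : X → Bool) (xs : List X) → countL g (filterᵇ p xs) ≡ countL (λ x → p x ∧ g x) xs
  countL-filterᵇ p g [] = refl
  countL-filterᵇ p g (x ∷ xs) with p x
  ... | true = cong (⟦ g x ⟧ +_) (countL-filterᵇ p g xs)
  ... | false = countL-filterᵇ p g xs

sumF-map : {X Y : Set} (f : Y → ℕ) (g : X → Y) (xs : List X) → sumF f (map g xs) ≡ sumF (f ∘ g) xs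
sumF-map f g [] = refl
sumF-map f g (x ∷ xs) = cong (f (g x) +_) (sumF-map f g xs)

sumF-swap : {X Y : Set} (g : X → Y → ℕ) (xs : List X) (ys : List Y) →
  sumF (λ x → sumF (g x) ys) xs ≡ sumF (λ y → sumF (λ x → g x y) xs) ys
sumF-swap g [] ys = sym (sumF-zero _ ys (λ _ _ → refl))
sumF-swap g (x ∷ xs) ys = trans (cong (sumF (g x) ys +_) (sumF-swap g xs ys))
  (sym (sumF-+ (g x) (λ y → sumF (λ x′ → g x′ y) xs) ys))

⟦⟧≤1 : ∀ b → ⟦ b ⟧ ≤ 1
⟦⟧≤1 true = s≤s z≤n
⟦⟧≤1 false = z≤n

⟦xor⟧≤⟦⟧+⟦⟧ : ∀ a b → ⟦ a xor b ⟧ ≤ ⟦ a ⟧ + ⟦ b ⟧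
⟦xor⟧≤⟦⟧+⟦⟧ true true = z≤n
⟦xor⟧≤⟦⟧+⟦⟧ true false = s≤s z≤n
⟦xor⟧≤⟦⟧+⟦⟧ false true = s≤s z≤n
⟦xor⟧≤⟦⟧+⟦⟧ false false = z≤n

⟦⟧+⟦⟧≤⟦∨⟧ : ∀ a b → ¬ (a ≡ true × b ≡ true) → ⟦ a ⟧ + ⟦ b ⟧ ≤ ⟦ a ∨ b ⟧
⟦⟧+⟦⟧≤⟦∨⟧ true true h = ⊥-elim (h (refl , refl))
⟦⟧+⟦⟧≤⟦∨⟧ true false h = s≤s z≤n
⟦⟧+⟦⟧≤⟦∨⟧ false true h = s≤s z≤n
⟦⟧+⟦⟧≤⟦∨⟧ false false h = z≤n

xor≡∨-disjoint : ∀ a b → ¬ (a ≡ true × b ≡ true) → a xor b ≡ b ∨ a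
xor≡∨-disjoint true true h = ⊥-elim (h (refl , refl))
xor≡∨-disjoint true false h = refl
xor≡∨-disjoint false true h = refl
xor≡∨-disjoint false false h = refl

oddᵇ : ℕ → Bool
oddᵇ zero = false
oddᵇ (suc n) = not (oddᵇ n)

oddᵇ-+ : ∀ m n → oddᵇ (m + n) ≡ oddᵇ m xor oddᵇ n
oddᵇ-+ zero n = refl
oddᵇ-+ (suc m) n = trans (cong not (oddᵇ-+ m n)) (not-distribˡ-xor (oddᵇ m) (oddᵇ n))

oddᵇ-⟦⟧ : ∀ b → oddᵇ ⟦ b ⟧ ≡ b
oddᵇ-⟦⟧ true = refl
oddᵇ-⟦⟧ false = refl

Even⇒oddᵇ≡false : ∀ n → Even n → oddᵇ n ≡ false
Even⇒oddᵇ≡false n (divides q refl) = oddᵇ-*2 q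
  where
  oddᵇ-*2 : ∀ q → oddᵇ (q * 2) ≡ false
  oddᵇ-*2 zero = refl
  oddᵇ-*2 (suc q) = trans (not-involutive (oddᵇ (q * 2))) (oddᵇ-*2 q)

oddᵇ≡false⇒Even : ∀ n → oddᵇ n ≡ false → Even n
oddᵇ≡false⇒Even zero _ = divides 0 refl
oddᵇ≡false⇒Even (suc zero) ()
oddᵇ≡false⇒Even (suc (suc n)) h with oddᵇ≡false⇒Even n (trans (sym (not-involutive (oddᵇ n))) h)
... | divides q eq = divides (suc q) (cong (λ k → suc (suc k)) eq)

Odd⇒oddᵇ≡true : ∀ n → Odd n → oddᵇ n ≡ true
Odd⇒oddᵇ≡true n h with oddᵇ n in eq
... | true = refl
... | false = ⊥-elim (h (oddᵇ≡false⇒Even n eq))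

oddᵇ≡true⇒Odd : ∀ n → oddᵇ n ≡ true → Odd n
oddᵇ≡true⇒Odd n h e with trans (sym h) (Even⇒oddᵇ≡false n e)
... | ()

oddᵇ≡true⇒1≤ : ∀ n → oddᵇ n ≡ true → 1 ≤ n
oddᵇ≡true⇒1≤ (suc n) _ = s≤s z≤n

module _ {X : Set} where

  oddᵇ-sumF-cong : {f g : X → ℕ} (xs : List X) → (∀ x → x ∈ xs → oddᵇ (f x) ≡ oddᵇ (g x)) →
    oddᵇ (sumF f xs) ≡ oddᵇ (sumF g xs)
  oddᵇ-sumF-cong [] h = refl
  oddᵇ-sumF-cong {f} {g} (x ∷ xs) h =
    trans (oddᵇ-+ (f x) _)
    (trans (cong₂ _xor_ (h x (here refl)) (oddᵇ-sumF-cong xs (λ y y∈ → h y (there y∈))))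
           (sym (oddᵇ-+ (g x) _)))

  oddᵇ-countL : (p : X → Bool) (x : X) (xs : List X) →
    oddᵇ (countL p (x ∷ xs)) ≡ p x xor oddᵇ (countL p xs)
  oddᵇ-countL p x xs = trans (oddᵇ-+ ⟦ p x ⟧ _) (cong (_xor oddᵇ (countL p xs)) (oddᵇ-⟦⟧ (p x)))

  oddᵇ-countL-xor : (p q : X → Bool) (xs : List X) →
    oddᵇ (countL (λ x → p x xor q x) xs) ≡ oddᵇ (countL p xs) xor oddᵇ (countL q xs)
  oddᵇ-countL-xor p q [] = refl
  oddᵇ-countL-xor p q (x ∷ xs) =
    trans (oddᵇ-countL (λ x → p x xor q x) x xs)
    (trans (cong ((p x xor q x) xor_) (oddᵇ-countL-xor p q xs))
    (trans (xor-interchange (p x) (q x) _ _)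
           (sym (cong₂ _xor_ (oddᵇ-countL p x xs) (oddᵇ-countL q x xs)))))

  oddᵇ-countL-const : (c : Bool) (xs : List X) → oddᵇ (countL (λ _ → c) xs) ≡ c ∧ oddᵇ (length xs)
  oddᵇ-countL-const false xs = cong oddᵇ (countL-zero _ xs (λ _ _ → refl))
  oddᵇ-countL-const true xs = cong oddᵇ (sym (length≡countL-true xs))

≡ᵇ-refl : ∀ n → (n ≡ᵇ n) ≡ true
≡ᵇ-refl zero = refl
≡ᵇ-refl (suc n) = ≡ᵇ-refl n

≡ᵇ-sym : ∀ m n → (m ≡ᵇ n) ≡ (n ≡ᵇ m)
≡ᵇ-sym zero zero = refl
≡ᵇ-sym zero (suc n) = refl
≡ᵇ-sym (suc m) zero = refl
≡ᵇ-sym (suc m) (suc n) = ≡ᵇ-sym m n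

≡ᵇ-true : ∀ m n → (m ≡ᵇ n) ≡ true → m ≡ n
≡ᵇ-true m n h = ≡ᵇ⇒≡ m n (Equivalence.from T-≡ h)

≡ᵇ-false : ∀ m n → m ≢ n → (m ≡ᵇ n) ≡ false
≡ᵇ-false m n ne with m ≡ᵇ n in eq
... | true = ⊥-elim (ne (≡ᵇ-true m n eq))
... | false = refl

memᵇ-∈ : ∀ x xs → memᵇ x xs ≡ true → x ∈ xs
memᵇ-∈ x (y ∷ ys) h with y ≡ᵇ x in eq
... | true = here (sym (≡ᵇ-true y x eq))
... | false = there (memᵇ-∈ x ys h)

∈-memᵇ : ∀ x xs → x ∈ xs → memᵇ x xs ≡ true
∈-memᵇ x (y ∷ ys) (here refl) rewrite ≡ᵇ-refl x = refl
∈-memᵇ x (y ∷ ys) (there p) with y ≡ᵇ x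
... | true = refl
... | false = ∈-memᵇ x ys p

∉-memᵇ : ∀ x xs → x ∉ xs → memᵇ x xs ≡ false
∉-memᵇ x xs h with memᵇ x xs in eq
... | true = ⊥-elim (h (memᵇ-∈ x xs eq))
... | false = refl

memᵇ-∉ : ∀ x xs → memᵇ x xs ≡ false → x ∉ xs
memᵇ-∉ x xs h p with trans (sym h) (∈-memᵇ x xs p)
... | ()

countL-≡ᵇ : (xs : List ℕ) → Unique xs → ∀ x → countL (_≡ᵇ x) xs ≡ ⟦ memᵇ x xs ⟧
countL-≡ᵇ [] u x = refl
countL-≡ᵇ (y ∷ ys) (y∉ ∷ u) x with y ≡ᵇ x in eq
... | true = cong suc (countL-zero _ ys (λ z z∈ → ≡ᵇ-false z x (λ z≡x →
                All¬⇒¬Any y∉ (subst (_∈ ys) (trans z≡x (sym (≡ᵇ-true y x eq))) z∈))))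
... | false = countL-≡ᵇ ys u x

countL-≡ᵇ′ : (xs : List ℕ) → Unique xs → ∀ x → countL (x ≡ᵇ_) xs ≡ ⟦ memᵇ x xs ⟧
countL-≡ᵇ′ xs u x = trans (sumF-cong xs (λ y _ → cong ⟦_⟧ (≡ᵇ-sym x y))) (countL-≡ᵇ xs u x)

oddᵇ-countL-≡ᵇ′ : (xs : List ℕ) → Unique xs → ∀ x → oddᵇ (countL (x ≡ᵇ_) xs) ≡ memᵇ x xs
oddᵇ-countL-≡ᵇ′ xs u x = trans (cong oddᵇ (countL-≡ᵇ′ xs u x)) (oddᵇ-⟦⟧ _)

memᵇ-cong : ∀ {X Y x} → x ∈ X ⇔ x ∈ Y → memᵇ x X ≡ memᵇ x Y
memᵇ-cong {X} {Y} {x} X⇔Y with x ∈? X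
... | yes p = trans (∈-memᵇ x X p) (sym (∈-memᵇ x Y (Equivalence.to X⇔Y p)))
... | no p = trans (∉-memᵇ x X p) (sym (∉-memᵇ x Y (p ∘ Equivalence.from X⇔Y)))

length≡countL-memᵇ : (L X : List ℕ) → Unique L → Unique X → (∀ y → y ∈ L → y ∈ X) →
  length L ≡ countL (λ v → memᵇ v L) X
length≡countL-memᵇ L X uL uX L⊆X =
  trans (length≡sum-≡ᵇ L L⊆X)
  (trans (sumF-swap (λ y v → ⟦ y ≡ᵇ v ⟧) L X) (sumF-cong X (λ v _ → countL-≡ᵇ L uL v)))
  where
  length≡sum-≡ᵇ : ∀ L′ → (∀ y → y ∈ L′ → y ∈ X) → length L′ ≡ sumF (λ y → countL (y ≡ᵇ_) X) L′
  length≡sum-≡ᵇ [] h = refl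
  length≡sum-≡ᵇ (y ∷ L′) h = cong₂ _+_ (sym (trans (countL-≡ᵇ′ X uX y) (cong ⟦_⟧ (∈-memᵇ y X (h y (here refl))))))
                                       (length≡sum-≡ᵇ L′ (λ z z∈ → h z (there z∈)))

count-false : ∀ n → count {n} (λ _ → false) ≡ 0
count-false zero = refl
count-false (suc n) = count-false n

count-cong : ∀ {n} {p q : Fin n → Bool} → (∀ i → p i ≡ q i) → count p ≡ count q
count-cong {zero} h = refl
count-cong {suc n} h = cong₂ _+_ (cong ⟦_⟧ (h zero)) (count-cong (h ∘ suc))

countL-tabulate : ∀ {n} {X : Set} (p : X → Bool) (f : Fin n → X) → countL p (tabulate f) ≡ count (p ∘ f)
countL-tabulate {zero} p f = refl
countL-tabulate {suc n} p f = cong (⟦ p (f zero) ⟧ +_) (countL-tabulate p (f ∘ suc))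

count≡countL-allFin : ∀ {n} (p : Fin n → Bool) → count p ≡ countL p (allFin n)
count≡countL-allFin p = sym (countL-tabulate p (λ i → i))

count-permute : ∀ {m n} (π : Fin m ↔ Fin n) (p : Fin n → Bool) → count (p ∘ Inverse.to π) ≡ count p
count-permute π p =
  trans (count≡sum (p ∘ Inverse.to π)) (trans (sym (sum-permute (λ j → ⟦ p j ⟧) π)) (sym (count≡sum p)))
  where
  count≡sum : ∀ {k} (q : Fin k → Bool) → count q ≡ sum (λ i → ⟦ q i ⟧)
  count≡sum {zero} q = refl
  count≡sum {suc k} q = cong (⟦ q zero ⟧ +_) (count≡sum (q ∘ suc))

eqF : ∀ {n} → Fin n → Fin n → Bool
eqF zero zero = true
eqF zero (suc j) = false
eqF (suc i) zero = false
eqF (suc i) (suc j) = eqF i j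

eqF-refl : ∀ {n} (i : Fin n) → eqF i i ≡ true
eqF-refl zero = refl
eqF-refl (suc i) = eqF-refl i

eqF-true : ∀ {n} (i j : Fin n) → eqF i j ≡ true → i ≡ j
eqF-true zero zero h = refl
eqF-true (suc i) (suc j) h = cong suc (eqF-true i j h)

memF : ∀ {n} → Fin n → List (Fin n) → Bool
memF i [] = false
memF i (c ∷ C) = eqF c i ∨ memF i C

memF-∈ : ∀ {n} (i : Fin n) C → memF i C ≡ true → i ∈ C
memF-∈ i (c ∷ C) h with eqF c i in eq
... | true = here (sym (eqF-true c i eq))
... | false = there (memF-∈ i C h)

∈-memF : ∀ {n} (i : Fin n) C → i ∈ C → memF i C ≡ true
∈-memF i (c ∷ C) (here refl) rewrite eqF-refl i = refl
∈-memF i (c ∷ C) (there p) with eqF c i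
... | true = refl
... | false = ∈-memF i C p

count-eqF : ∀ {n} (c : Fin n) (g : Fin n → Bool) → count (λ i → eqF c i ∧ g i) ≡ ⟦ g c ⟧
count-eqF {suc n} zero g = trans (cong (⟦ g zero ⟧ +_) (count-false n)) (+-identityʳ _)
count-eqF {suc n} (suc c) g = count-eqF c (g ∘ suc)

count-∨ : ∀ {n} (p q g : Fin n → Bool) → (∀ i → p i ≡ true → q i ≡ false) →
  count (λ i → (p i ∨ q i) ∧ g i) ≡ count (λ i → p i ∧ g i) + count (λ i → q i ∧ g i)
count-∨ {zero} p q g h = refl
count-∨ {suc n} p q g h with p zero in ep | count-∨ (p ∘ suc) (q ∘ suc) (g ∘ suc) (h ∘ suc)
... | true | ih rewrite h zero ep = trans (cong (⟦ g zero ⟧ +_) ih) (sym (+-assoc ⟦ g zero ⟧ _ _))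
... | false | ih = trans (cong (⟦ q zero ∧ g zero ⟧ +_) ih) (+-left-comm ⟦ q zero ∧ g zero ⟧ (count (λ i → p (suc i) ∧ g (suc i))) _)

count-memF : ∀ {n} (C : List (Fin n)) → Unique C → (g : Fin n → Bool) →
  count (λ i → memF i C ∧ g i) ≡ countL g C
count-memF {n} [] u g = count-false n
count-memF (c ∷ C) (c∉ ∷ u) g =
  trans (count-∨ (eqF c) (λ i → memF i C) g c∉C)
        (cong₂ _+_ (count-eqF c g) (count-memF C u g))
  where
  c∉C : ∀ i → eqF c i ≡ true → memF i C ≡ false
  c∉C i e with memF i C in eq
  ... | false = refl
  ... | true with eqF-true c i e
  ... | refl = ⊥-elim (All¬⇒¬Any c∉ (memF-∈ c C eq))

module Witnesses {n : ℕ} (R : Fin n → ℕ → Set) where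

  witnesses : ∀ {B} → All (λ b → Σ (Fin n) λ i → R i b) B → List (Fin n)
  witnesses [] = []
  witnesses (p ∷ ps) = proj₁ p ∷ witnesses ps

  countL-witnesses : ∀ {B} (ch : All (λ b → Σ (Fin n) λ i → R i b) B) (g : Fin n → Bool) (k : ℕ → Bool) →
    (∀ i b → R i b → g i ≡ k b) → countL g (witnesses ch) ≡ countL k B
  countL-witnesses [] g k h = refl
  countL-witnesses ((i , Ri) ∷ ps) g k h = cong₂ _+_ (cong ⟦_⟧ (h i _ Ri)) (countL-witnesses ps g k h)

  ∈-witnesses⁻ : ∀ {B} (ch : All (λ b → Σ (Fin n) λ i → R i b) B) → ∀ j → j ∈ witnesses ch →
    Σ ℕ λ b → b ∈ B × R j b
  ∈-witnesses⁻ ((i , Ri) ∷ ps) j (here refl) = _ , here refl , Ri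
  ∈-witnesses⁻ (p ∷ ps) j (there q) with ∈-witnesses⁻ ps j q
  ... | b , b∈ , Rb = b , there b∈ , Rb

  ∈-witnesses⁺ : ∀ {B} (ch : All (λ b → Σ (Fin n) λ i → R i b) B) → ∀ b → b ∈ B →
    Σ (Fin n) λ j → j ∈ witnesses ch × R j b
  ∈-witnesses⁺ ((i , Ri) ∷ ps) b (here refl) = i , here refl , Ri
  ∈-witnesses⁺ (p ∷ ps) b (there q) with ∈-witnesses⁺ ps b q
  ... | j , j∈ , Rj = j , there j∈ , Rj

  witnesses-unique : ∀ {B} (ch : All (λ b → Σ (Fin n) λ i → R i b) B) → Unique B →
    (∀ i b c → R i b → R i c → b ≡ c) → Unique (witnesses ch)
  witnesses-unique [] u inj = []
  witnesses-unique {b ∷ B} ((i , Ri) ∷ ps) (b∉ ∷ u) inj = distinct ps b∉ ∷ witnesses-unique ps u inj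
    where
    distinct : ∀ {B′} (qs : All (λ b → Σ (Fin n) λ i → R i b) B′) → All (b ≢_) B′ → All (i ≢_) (witnesses qs)
    distinct [] _ = []
    distinct ((j , Rj) ∷ qs) (ne ∷ nes) = (λ { refl → ne (inj i b _ Ri Rj) }) ∷ distinct qs nes

EdgeEq-refl : ∀ e → EdgeEq e e
EdgeEq-refl (a , b) = inj₁ (refl , refl)

EdgeEq-sym : ∀ {e e′} → EdgeEq e e′ → EdgeEq e′ e
EdgeEq-sym {a , b} {c , d} (inj₁ (refl , refl)) = inj₁ (refl , refl)
EdgeEq-sym {a , b} {c , d} (inj₂ (refl , refl)) = inj₂ (refl , refl)

EdgeEq-trans : ∀ {e e′ e″} → EdgeEq e e′ → EdgeEq e′ e″ → EdgeEq e e″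
EdgeEq-trans {a , b} {c , d} {x , y} (inj₁ (refl , refl)) q = q
EdgeEq-trans {a , b} {c , d} {x , y} (inj₂ (refl , refl)) (inj₁ (refl , refl)) = inj₂ (refl , refl)
EdgeEq-trans {a , b} {c , d} {x , y} (inj₂ (refl , refl)) (inj₂ (refl , refl)) = inj₁ (refl , refl)

EdgeEq-flip : ∀ {e u x} → EdgeEq e (u , x) → EdgeEq e (x , u)
EdgeEq-flip {a , b} (inj₁ (p , q)) = inj₂ (p , q)
EdgeEq-flip {a , b} (inj₂ (p , q)) = inj₁ (p , q)

EdgeEq⇒Ends : ∀ {e x y} → EdgeEq e (x , y) → Ends x e
EdgeEq⇒Ends {a , b} (inj₁ (refl , refl)) = inj₁ refl
EdgeEq⇒Ends {a , b} (inj₂ (refl , refl)) = inj₂ refl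

Ends-resp-EdgeEq : ∀ {u e e′} → EdgeEq e e′ → Ends u e → Ends u e′
Ends-resp-EdgeEq {u} {a , b} {c , d} (inj₁ (refl , refl)) en = en
Ends-resp-EdgeEq {u} {a , b} {c , d} (inj₂ (refl , refl)) (inj₁ p) = inj₂ p
Ends-resp-EdgeEq {u} {a , b} {c , d} (inj₂ (refl , refl)) (inj₂ p) = inj₁ p

inCutᵇ⇒Ends : ∀ v e → inCutᵇ v e ≡ true → Ends v e
inCutᵇ⇒Ends v (a , b) h with a ≡ᵇ v in ea | b ≡ᵇ v in eb
... | true | _ = inj₁ (sym (≡ᵇ-true a v ea))
... | false | true = inj₂ (sym (≡ᵇ-true b v eb))
inCutᵇ⇒Ends v (a , b) () | false | false

inCutᵇ-avoid : ∀ v e → proj₁ e ≢ v → proj₂ e ≢ v → inCutᵇ v e ≡ false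
inCutᵇ-avoid v (a , b) na nb rewrite ≡ᵇ-false a v na | ≡ᵇ-false b v nb = refl

inCutᵇ-resp-EdgeEq : ∀ v {e e′} → EdgeEq e e′ → inCutᵇ v e ≡ inCutᵇ v e′
inCutᵇ-resp-EdgeEq v {a , b} {c , d} (inj₁ (refl , refl)) = refl
inCutᵇ-resp-EdgeEq v {a , b} {c , d} (inj₂ (refl , refl)) = xor-comm (a ≡ᵇ v) (b ≡ᵇ v)

crossᵇ : List ℕ → Edge → Bool
crossᵇ X e = memᵇ (proj₁ e) X xor memᵇ (proj₂ e) X

crossᵇ-inside : ∀ X e → proj₁ e ∈ X → proj₂ e ∈ X → crossᵇ X e ≡ false
crossᵇ-inside X (a , b) ha hb rewrite ∈-memᵇ a X ha | ∈-memᵇ b X hb = refl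

handshake : (X : List ℕ) → Unique X → (N : List Edge) →
  oddᵇ (sumF (λ v → countL (inCutᵇ v) N) X) ≡ oddᵇ (countL (crossᵇ X) N)
handshake X u N =
  trans (cong oddᵇ (sumF-swap (λ v e → ⟦ inCutᵇ v e ⟧) X N)) (oddᵇ-sumF-cong N (λ e _ → per-edge e))
  where
  per-edge : ∀ e → oddᵇ (countL (λ v → inCutᵇ v e) X) ≡ oddᵇ ⟦ crossᵇ X e ⟧
  per-edge (a , b) =
    trans (oddᵇ-countL-xor (a ≡ᵇ_) (b ≡ᵇ_) X)
    (trans (cong₂ _xor_ (oddᵇ-countL-≡ᵇ′ X u a) (oddᵇ-countL-≡ᵇ′ X u b)) (sym (oddᵇ-⟦⟧ _)))

sel : (E : List Edge) → (Fin (length E) → Bool) → List Edge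
sel [] F = []
sel (e ∷ E) F = if F zero then e ∷ sel E (F ∘ suc) else sel E (F ∘ suc)

countL-sel : (E : List Edge) (F : Fin (length E) → Bool) (q : Edge → Bool) →
  count (λ i → F i ∧ q (lookup E i)) ≡ countL q (sel E F)
countL-sel [] F q = refl
countL-sel (e ∷ E) F q with F zero
... | true = cong (⟦ q e ⟧ +_) (countL-sel E (F ∘ suc) q)
... | false = countL-sel E (F ∘ suc) q

count≡length-sel : (E : List Edge) (F : Fin (length E) → Bool) → count F ≡ length (sel E F)
count≡length-sel [] F = refl
count≡length-sel (e ∷ E) F with F zero
... | true = cong suc (count≡length-sel E (F ∘ suc))
... | false = count≡length-sel E (F ∘ suc)

∈-sel⁻ : (E : List Edge) (F : Fin (length E) → Bool) → ∀ e → e ∈ sel E F →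
  Σ (Fin (length E)) λ i → F i ≡ true × lookup E i ≡ e
∈-sel⁻ (e′ ∷ E) F e h with F zero in eq
∈-sel⁻ (e′ ∷ E) F e (here refl) | true = zero , eq , refl
∈-sel⁻ (e′ ∷ E) F e (there h) | true with ∈-sel⁻ E (F ∘ suc) e h
... | i , Fi , lk = suc i , Fi , lk
∈-sel⁻ (e′ ∷ E) F e h | false with ∈-sel⁻ E (F ∘ suc) e h
... | i , Fi , lk = suc i , Fi , lk

∈-sel⁺ : (E : List Edge) (F : Fin (length E) → Bool) → ∀ i → F i ≡ true → lookup E i ∈ sel E F
∈-sel⁺ (e ∷ E) F zero h rewrite h = here refl
∈-sel⁺ (e ∷ E) F (suc i) h with F zero
... | true = there (∈-sel⁺ E (F ∘ suc) i h)
... | false = ∈-sel⁺ E (F ∘ suc) i h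

sel-⊆ : (E : List Edge) (F : Fin (length E) → Bool) → ∀ e → e ∈ sel E F → e ∈ E
sel-⊆ E F e h with ∈-sel⁻ E F e h
... | i , _ , refl = ∈-lookup i

sel-sublist : (E : List Edge) (F : Fin (length E) → Bool) → sel E F ⊆ E
sel-sublist [] F = []
sel-sublist (e ∷ E) F with F zero
... | true = refl ∷ sel-sublist E (F ∘ suc)
... | false = e ∷ʳ sel-sublist E (F ∘ suc)

selector : ∀ {M E : List Edge} → M ⊆ E → Fin (length E) → Bool
selector (e ∷ʳ s) zero = false
selector (e ∷ʳ s) (suc i) = selector s i
selector (refl ∷ s) zero = true
selector (refl ∷ s) (suc i) = selector s i

sel-selector : ∀ {M E : List Edge} (s : M ⊆ E) → sel E (selector s) ≡ M
sel-selector [] = refl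
sel-selector (e ∷ʳ s) = sel-selector s
sel-selector (refl ∷ s) = cong (_ ∷_) (sel-selector s)

module _ {G : Graph} {F : EdgeSet G} where

  deg≡countL-sel : ∀ v → deg G F v ≡ countL (inCutᵇ v) (sel (E G) F)
  deg≡countL-sel v = countL-sel (E G) F (inCutᵇ v)

  sel-ends : WF G → ∀ e → e ∈ sel (E G) F → proj₁ e ∈ V G × proj₂ e ∈ V G
  sel-ends wf e h = proj₂ wf e (sel-⊆ (E G) F e h)

  ∈-sel⇒selected : ∀ e → e ∈ sel (E G) F → Σ (EIdx G) λ i → F i ≡ true × EdgeEq (edge G i) e
  ∈-sel⇒selected e h with ∈-sel⁻ (E G) F e h
  ... | i , Fi , refl = i , Fi , EdgeEq-refl _

∈⇒index : ∀ {G : Graph} {e} → e ∈ E G → Σ (EIdx G) λ i → edge G i ≡ e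
∈⇒index e∈ = Any.index e∈ , sym (lookup-index e∈)

data ReachL (N : List Edge) : ℕ → ℕ → Set where
  here : ∀ {u} → ReachL N u u
  step : ∀ {u x w} e → e ∈ N → EdgeEq e (u , x) → ReachL N x w → ReachL N u w

ReachL-trans : ∀ {N u v w} → ReachL N u v → ReachL N v w → ReachL N u w
ReachL-trans here q = q
ReachL-trans (step e e∈ eq p) q = step e e∈ eq (ReachL-trans p q)

ReachL-⊆ : ∀ {N N′ u w} → (∀ e → e ∈ N → e ∈ N′) → ReachL N u w → ReachL N′ u w
ReachL-⊆ h here = here
ReachL-⊆ h (step e e∈ eq p) = step e (h e e∈) eq (ReachL-⊆ h p)

CoversL : List Edge → ℕ → Set
CoversL N u = Σ Edge λ e → e ∈ N × Ends u e

module _ {G : Graph} {F : EdgeSet G} where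

  Reach-trans : ∀ {u v w} → Reach G F u v → Reach G F v w → Reach G F u w
  Reach-trans Reach.here q = q
  Reach-trans (Reach.step i Fi eq p) q = Reach.step i Fi eq (Reach-trans p q)

  Reach-sym : ∀ {u w} → Reach G F u w → Reach G F w u
  Reach-sym Reach.here = Reach.here
  Reach-sym (Reach.step i Fi eq p) = Reach-trans (Reach-sym p) (Reach.step i Fi (EdgeEq-flip eq) Reach.here)

  Reach⇒ReachL : ∀ {u w} → Reach G F u w → ReachL (sel (E G) F) u w
  Reach⇒ReachL Reach.here = here
  Reach⇒ReachL (Reach.step i Fi eq p) = step _ (∈-sel⁺ (E G) F i Fi) eq (Reach⇒ReachL p)

  ReachL⇒Reach : ∀ {N u w} → (∀ e → e ∈ N → Σ (EIdx G) λ i → F i ≡ true × EdgeEq (edge G i) e) →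
    ReachL N u w → Reach G F u w
  ReachL⇒Reach h here = Reach.here
  ReachL⇒Reach h (step e e∈ eq p) with h e e∈
  ... | i , Fi , eq′ = Reach.step i Fi (EdgeEq-trans eq′ eq) (ReachL⇒Reach h p)

  Covers⇒CoversL : ∀ {u} → Covers G F u → CoversL (sel (E G) F) u
  Covers⇒CoversL (i , Fi , en) = edge G i , ∈-sel⁺ (E G) F i Fi , en

  CoversL⇒Covers : ∀ {u} → CoversL (sel (E G) F) u → Covers G F u
  CoversL⇒Covers (e , e∈ , en) with ∈-sel⁻ (E G) F e e∈
  ... | i , Fi , refl = i , Fi , en

-- Rooted joins

touchesᵇ : (ℕ → Bool) → Edge → Bool
touchesᵇ p e = p (proj₁ e) ∨ p (proj₂ e)

innerᵇ : Graph → List ℕ → ℕ → Bool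
innerᵇ G A v = memᵇ v (V G) ∧ not (memᵇ v A)

InE : List Edge → Edge → Set
InE Es e = Σ Edge λ e′ → e′ ∈ Es × EdgeEq e e′

-- The edges that can occur in a graph containing G in which nothing outside G is adjacent to
-- V(G) ∖ A, such as G + H + S.
Admissible : Graph → List ℕ → Edge → Set
Admissible G A e =
  InE (E G) e ⊎ (proj₁ e ∈ A × proj₂ e ∉ V G) ⊎ (proj₂ e ∈ A × proj₁ e ∉ V G) ⊎
  (proj₁ e ∉ V G × proj₂ e ∉ V G)

record RootedJoin (r : ℕ) (A : List ℕ) (G : Graph) (T : List ℕ) : Set where
  field
    wf : WF G
    T⊆V : ∀ t → t ∈ T → t ∈ V G
    A⊆V : ∀ x → x ∈ A → x ∈ V G
    r∈A : r ∈ A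
    F : EdgeSet G
    parity : ∀ v → v ∈ V G → oddᵇ (deg G F v) ≡ memᵇ v T
    reaches-root : ∀ u → Covers G F u → Reach G F u r
    covers-root : Covers G F r
    -- The parity at r is left free: gluing at a tooth b replaces T_b by T_b Δ {r_b}.
    lower-bound : ∀ N → All (Admissible G A) N →
      (∀ v → v ∈ V G → v ≢ r → oddᵇ (countL (inCutᵇ v) N) ≡ memᵇ v T) →
      count F ≤ countL (touchesᵇ (innerᵇ G A)) N

join⇒even-T : ∀ {G T} {F : EdgeSet G} → WF G → (∀ v → v ∈ V G → oddᵇ (deg G F v) ≡ memᵇ v T) →
  oddᵇ (countL (λ v → memᵇ v T) (V G)) ≡ false
join⇒even-T {G} {T} {F} wf parity =
  trans (oddᵇ-sumF-cong (V G) (λ v v∈ →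
          trans (oddᵇ-⟦⟧ _) (trans (sym (parity v v∈)) (cong oddᵇ (deg≡countL-sel {G} {F} v)))))
  (trans (handshake (V G) (proj₁ wf) (sel (E G) F))
         (cong oddᵇ (countL-zero _ _ (λ e e∈ → crossᵇ-inside (V G) e (proj₁ (ends e e∈)) (proj₂ (ends e e∈))))))
  where
  ends = sel-ends {G} {F} wf

-- Attaching H along A

module Extension {r A G T} (J : RootedJoin r A G T)
  (H : Graph) (graftH : IsGraft H []) (disjoint : Disjoint (V G) (V H))
  (S : List Edge) (S-between : ∀ e → e ∈ S → (proj₁ e ∈ A × proj₂ e ∈ V H) ⊎ (proj₂ e ∈ A × proj₁ e ∈ V H))
  where

  open RootedJoin J

  K : Graph
  K = G ⊕ H ⊕ S

  M : List Edge
  M = sel (E G) F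

  M⊆EK : M ⊆ E K
  M⊆EK = Sublist.++⁺ʳ (E H ++ S) (sel-sublist (E G) F)

  FK : EdgeSet K
  FK = selector M⊆EK

  sel-FK : sel (E K) FK ≡ M
  sel-FK = sel-selector M⊆EK

  deg-FK : ∀ v → deg K FK v ≡ countL (inCutᵇ v) M
  deg-FK v = trans (deg≡countL-sel {K} {FK} v) (cong (countL (inCutᵇ v)) sel-FK)

  H∩G : ∀ x → x ∈ V H → x ∉ V G
  H∩G x xH xG = disjoint x xG xH

  edge-cases : ∀ e → e ∈ E K →
    e ∈ E G ⊎ (proj₁ e ∈ V H × proj₂ e ∈ V H) ⊎ (proj₁ e ∈ A × proj₂ e ∈ V H) ⊎ (proj₂ e ∈ A × proj₁ e ∈ V H)
  edge-cases e h with ∈-++⁻ (E G) h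
  ... | inj₁ p = inj₁ p
  ... | inj₂ q with ∈-++⁻ (E H) q
  ... | inj₁ p = inj₂ (inj₁ (proj₂ (proj₁ graftH) e p))
  ... | inj₂ p = inj₂ (inj₂ (S-between e p))

  wfK : WF K
  wfK = Unique.++⁺ (proj₁ wf) (proj₁ (proj₁ graftH)) (λ {x} (xG , xH) → disjoint x xG xH) , ends
    where
    ends : ∀ e → e ∈ E K → proj₁ e ∈ V K × proj₂ e ∈ V K
    ends e h with edge-cases e h
    ... | inj₁ p = ∈-++⁺ˡ (proj₁ (proj₂ wf e p)) , ∈-++⁺ˡ (proj₂ (proj₂ wf e p))
    ... | inj₂ (inj₁ (a , b)) = ∈-++⁺ʳ (V G) a , ∈-++⁺ʳ (V G) b
    ... | inj₂ (inj₂ (inj₁ (a , b))) = ∈-++⁺ˡ (A⊆V _ a) , ∈-++⁺ʳ (V G) b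
    ... | inj₂ (inj₂ (inj₂ (b , a))) = ∈-++⁺ʳ (V G) a , ∈-++⁺ˡ (A⊆V _ b)

  admissible : ∀ e → e ∈ E K → Admissible G A e
  admissible e h with edge-cases e h
  ... | inj₁ p = inj₁ (e , p , EdgeEq-refl e)
  ... | inj₂ (inj₁ (a , b)) = inj₂ (inj₂ (inj₂ (H∩G _ a , H∩G _ b)))
  ... | inj₂ (inj₂ (inj₁ (a , b))) = inj₂ (inj₁ (a , H∩G _ b))
  ... | inj₂ (inj₂ (inj₂ (b , a))) = inj₂ (inj₂ (inj₁ (b , H∩G _ a)))

  isJoin : IsJoin K T FK
  isJoin v v∈ = (λ v∈T → oddᵇ≡true⇒Odd _ (trans (parity-G v (T⊆V v v∈T)) (∈-memᵇ v T v∈T)))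
              , (λ v∉T → oddᵇ≡false⇒Even _ (even v v∉T))
    where
    parity-G : ∀ v → v ∈ V G → oddᵇ (deg K FK v) ≡ memᵇ v T
    parity-G v v∈ = trans (cong oddᵇ (trans (deg-FK v) (sym (deg≡countL-sel {G} {F} v)))) (parity v v∈)
    even : ∀ v → v ∉ T → oddᵇ (deg K FK v) ≡ false
    even v v∉T with v ∈? V G
    ... | yes p = trans (parity-G v p) (∉-memᵇ v T v∉T)
    ... | no p = cong oddᵇ (trans (deg-FK v) (countL-zero _ M (λ e e∈ → inCutᵇ-avoid v e
                   (λ { refl → p (proj₁ (sel-ends {G} {F} wf e e∈)) })
                   (λ { refl → p (proj₂ (sel-ends {G} {F} wf e e∈)) }))))

  isMinimal : ∀ F′ → IsJoin K T F′ → count FK ≤ count F′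
  isMinimal F′ join′ = begin
      count FK
    ≡⟨ trans (count≡length-sel (E K) FK) (trans (cong length sel-FK) (sym (count≡length-sel (E G) F))) ⟩
      count F
    ≤⟨ lower-bound N (All.tabulate (λ {e} e∈ → admissible e (sel-⊆ (E K) F′ e e∈))) parity′ ⟩
      countL (touchesᵇ (innerᵇ G A)) N
    ≤⟨ countL≤length _ N ⟩
      length N
    ≡⟨ sym (count≡length-sel (E K) F′) ⟩
      count F′ ∎
    where
    open ≤-Reasoning
    N : List Edge
    N = sel (E K) F′
    parity′ : ∀ v → v ∈ V G → v ≢ r → oddᵇ (countL (inCutᵇ v) N) ≡ memᵇ v T
    parity′ v v∈ _ with v ∈? T
    ... | yes p = trans (cong oddᵇ (sym (deg≡countL-sel {K} {F′} v)))
                    (trans (Odd⇒oddᵇ≡true _ (proj₁ (join′ v (∈-++⁺ˡ v∈)) p)) (sym (∈-memᵇ v T p)))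
    ... | no p = trans (cong oddᵇ (sym (deg≡countL-sel {K} {F′} v)))
                   (trans (Even⇒oddᵇ≡false _ (proj₂ (join′ v (∈-++⁺ˡ v∈)) p)) (sym (∉-memᵇ v T p)))

  selected-FK : ∀ e → e ∈ M → Σ (EIdx K) λ i → FK i ≡ true × EdgeEq (edge K i) e
  selected-FK e e∈ = ∈-sel⇒selected {K} {FK} e (subst (e ∈_) (sym sel-FK) e∈)

  covers-r : Covers K FK r
  covers-r = CoversL⇒Covers {K} {FK} (subst (λ L → CoversL L r) (sym sel-FK) (Covers⇒CoversL {G} {F} covers-root))

  to-root : ∀ u → Covers K FK u → Reach K FK u r
  to-root u c = ReachL⇒Reach {K} {FK} selected-FK (Reach⇒ReachL {G} {F}
    (reaches-root u (CoversL⇒Covers {G} {F} (subst (λ L → CoversL L u) sel-FK (Covers⇒CoversL {K} {FK} c)))))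

  isConnected : IsConnected K FK
  isConnected = (proj₁ covers-r , proj₁ (proj₂ covers-r))
              , (λ u w cu cw → Reach-trans (to-root u cu) (Reach-sym (to-root w cw)))

  T-reaches-root : ∀ u → u ∈ T → Reach K (allEdges K) u r
  T-reaches-root u u∈ with countL-pos (inCutᵇ u) M (oddᵇ≡true⇒1≤ _
    (trans (cong oddᵇ (sym (deg≡countL-sel {G} {F} u))) (trans (parity u (T⊆V u u∈)) (∈-memᵇ u T u∈))))
  ... | e , e∈ , cut = ReachL⇒Reach {K} {allEdges K}
          (λ e′ e′∈ → proj₁ (selected-FK e′ e′∈) , refl , proj₂ (proj₂ (selected-FK e′ e′∈)))
          (Reach⇒ReachL {G} {F} (reaches-root u (CoversL⇒Covers {G} {F} (e , e∈ , inCutᵇ⇒Ends u e cut))))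

  even-T : oddᵇ (countL (λ y → memᵇ y T) (V K)) ≡ false
  even-T = begin
      oddᵇ (countL (λ y → memᵇ y T) (V K))
    ≡⟨ cong oddᵇ (sumF-++ _ (V G) (V H)) ⟩
      oddᵇ (countL (λ y → memᵇ y T) (V G) + countL (λ y → memᵇ y T) (V H))
    ≡⟨ cong (λ k → oddᵇ (countL (λ y → memᵇ y T) (V G) + k))
            (countL-zero _ (V H) (λ y yH → ∉-memᵇ y T (λ yT → H∩G y yH (T⊆V y yT)))) ⟩
      oddᵇ (countL (λ y → memᵇ y T) (V G) + 0)
    ≡⟨ cong oddᵇ (+-identityʳ (countL (λ y → memᵇ y T) (V G))) ⟩
      oddᵇ (countL (λ y → memᵇ y T) (V G))
    ≡⟨ join⇒even-T {G} {T} {F} wf parity ⟩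
      false ∎
    where open ≡-Reasoning

  -- A component containing a vertex of T contains all of T, since every vertex of T reaches r.
  isGraft : IsGraft K T
  isGraft = wfK , (λ t t∈ → ∈-++⁺ˡ (T⊆V t t∈)) , even-components
    where
    even-components : ∀ v → v ∈ V K → (L : List ℕ) → Unique L →
      (∀ x → x ∈ L ⇔ (x ∈ T × Reach K (allEdges K) v x)) → Even (length L)
    even-components v v∈ [] uL spec = divides 0 refl
    even-components v v∈ L@(x ∷ _) uL spec = oddᵇ≡false⇒Even _ (trans (cong oddᵇ length-L) even-T)
      where
      x-info = Equivalence.to (spec x) (here refl)
      reach : ∀ y → y ∈ T → Reach K (allEdges K) v y
      reach y y∈ = Reach-trans (proj₂ x-info)
        (Reach-trans (T-reaches-root x (proj₁ x-info)) (Reach-sym (T-reaches-root y y∈)))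
      L≈T : ∀ y → memᵇ y L ≡ memᵇ y T
      L≈T y = memᵇ-cong (mk⇔ (proj₁ ∘ Equivalence.to (spec y)) (λ p → Equivalence.from (spec y) (p , reach y p)))
      length-L : length L ≡ countL (λ y → memᵇ y T) (V K)
      length-L = trans (length≡countL-memᵇ L (V K) uL (proj₁ wfK) (λ y y∈ → ∈-++⁺ˡ (T⊆V y (proj₁ (Equivalence.to (spec y) y∈)))))
                       (sumF-cong (V K) (λ y _ → cong ⟦_⟧ (L≈T y)))

-- Rakes

star-tooth-unique : ∀ {B : List ℕ} {r e b c} → r ∉ B → b ∈ B → EdgeEq e (r , b) → EdgeEq e (r , c) → b ≡ c
star-tooth-unique {B} r∉ b∈ p q with EdgeEq-trans (EdgeEq-sym p) q
... | inj₁ (_ , b≡c) = b≡c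
... | inj₂ (_ , refl) = ⊥-elim (r∉ b∈)

module _ {G T r B} (rake : IsRake G T r B) where

  open IsRake rake

  rake-memᵇ-T : ∀ x → memᵇ x T ≡ memᵇ x B ∨ ((r ≡ᵇ x) ∧ oddᵇ (length B))
  rake-memᵇ-T x with oddᵇ (length B) in odd-B
  ... | false = trans (memᵇ-cong (T-even (oddᵇ≡false⇒Even _ odd-B) x))
                      (sym (trans (cong (memᵇ x B ∨_) (∧-zeroʳ (r ≡ᵇ x))) (∨-identityʳ _)))
  ... | true = trans (memᵇ-cong (T⇔r∷B x)) (trans (∨-comm (r ≡ᵇ x) _) (cong (memᵇ x B ∨_) (sym (∧-identityʳ _))))
    where
    T⇔r∷B : ∀ x → x ∈ T ⇔ x ∈ r ∷ B
    T⇔r∷B x = mk⇔ (λ p → [ there , (λ { refl → here refl }) ]′ (to p))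
                   (λ { (here refl) → from (inj₂ refl) ; (there p) → from (inj₁ p) })
      where open Equivalence (T-odd (oddᵇ≡true⇒Odd _ odd-B) x)

  rake-T⊆V : ∀ t → t ∈ T → t ∈ V G
  rake-T⊆V t t∈ with memᵇ t B in t-B | r ≡ᵇ t in r-t
  ... | true | _ = B⊆V t (memᵇ-∈ t B t-B)
  ... | false | true = subst (_∈ V G) (≡ᵇ-true r t r-t) r∈V
  ... | false | false
    with trans (sym (∈-memᵇ t T t∈)) (trans (rake-memᵇ-T t) (cong₂ (λ a c → a ∨ (c ∧ oddᵇ (length B))) t-B r-t))
  ... | ()

module Rake {G T r B A} (rake : IsRake G T r B) (A-def : ∀ x → x ∈ A ⇔ (x ∈ V G × x ∉ B)) where

  open IsRake rake

  Spoke : EIdx G → ℕ → Set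
  Spoke i b = b ∈ B × EdgeEq (edge G i) (r , b)

  open Witnesses Spoke

  spokes : All (λ b → Σ (EIdx G) λ i → Spoke i b) B
  spokes = All.tabulate (λ {b} b∈ → proj₁ (r-adj b b∈) , b∈ , proj₂ (r-adj b b∈))

  spokes-unique : Unique (witnesses spokes)
  spokes-unique = witnesses-unique spokes B-unique (λ i b c p q → star-tooth-unique r∉B (proj₁ p) (proj₂ p) (proj₂ q))

  star : EdgeSet G
  star i = memF i (witnesses spokes)

  deg-star : ∀ v → deg G star v ≡ countL (λ b → inCutᵇ v (r , b)) B
  deg-star v = trans (count-memF _ spokes-unique (λ i → inCutᵇ v (edge G i)))
                     (countL-witnesses spokes _ _ (λ i b s → inCutᵇ-resp-EdgeEq v (proj₂ s)))

  count-star : count star ≡ length B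
  count-star =
    trans (count-cong (λ i → sym (∧-identityʳ (star i))))
    (trans (count-memF _ spokes-unique (λ _ → true))
    (trans (countL-witnesses spokes _ (λ _ → true) (λ _ _ _ → refl)) (sym (length≡countL-true B))))

  parity-star : ∀ v → v ∈ V G → oddᵇ (deg G star v) ≡ memᵇ v T
  parity-star v _ = begin
      oddᵇ (deg G star v)
    ≡⟨ cong oddᵇ (deg-star v) ⟩
      oddᵇ (countL (λ b → (r ≡ᵇ v) xor (b ≡ᵇ v)) B)
    ≡⟨ oddᵇ-countL-xor (λ _ → r ≡ᵇ v) (_≡ᵇ v) B ⟩
      oddᵇ (countL (λ _ → r ≡ᵇ v) B) xor oddᵇ (countL (_≡ᵇ v) B)
    ≡⟨ cong₂ _xor_ (oddᵇ-countL-const (r ≡ᵇ v) B) (trans (cong oddᵇ (countL-≡ᵇ B B-unique v)) (oddᵇ-⟦⟧ _)) ⟩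
      ((r ≡ᵇ v) ∧ oddᵇ (length B)) xor memᵇ v B
    ≡⟨ xor≡∨-disjoint _ _ not-both ⟩
      memᵇ v B ∨ ((r ≡ᵇ v) ∧ oddᵇ (length B))
    ≡⟨ sym (rake-memᵇ-T rake v) ⟩
      memᵇ v T ∎
    where
    open ≡-Reasoning
    not-both : ¬ ((r ≡ᵇ v) ∧ oddᵇ (length B) ≡ true × memᵇ v B ≡ true)
    not-both (h₁ , h₂) with r ≡ᵇ v in r≡v
    not-both (h₁ , h₂) | true = r∉B (subst (_∈ B) (sym (≡ᵇ-true r v r≡v)) (memᵇ-∈ v B h₂))
    not-both (() , h₂) | false

  star-reaches-root : ∀ u → Covers G star u → Reach G star u r
  star-reaches-root u (i , si , en) with ∈-witnesses⁻ spokes i (memF-∈ i _ si)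
  ... | b , _ , (b∈ , eq) with Ends-resp-EdgeEq eq en
  ... | inj₁ refl = Reach.here
  ... | inj₂ refl = Reach.step i si (EdgeEq-flip eq) Reach.here

  -- B is nonempty because r ∈ N_G(B).
  star-covers-root : Covers G star r
  star-covers-root with N-B r r∈V r∉B
  ... | b , b∈ , _ with ∈-witnesses⁺ spokes b b∈
  ... | j , j∈ , (_ , eq) = j , ∈-memF j _ j∈ , EdgeEq⇒Ends eq

  inner≡tooth : ∀ v → innerᵇ G A v ≡ memᵇ v B
  inner≡tooth v with v ∈? V G
  ... | no p rewrite ∉-memᵇ v (V G) p = sym (∉-memᵇ v B (λ q → p (B⊆V v q)))
  ... | yes p with v ∈? B
  ... | yes q rewrite ∈-memᵇ v (V G) p | ∉-memᵇ v A (λ a → proj₂ (Equivalence.to (A-def v) a) q)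
                    | ∈-memᵇ v B q = refl
  ... | no q rewrite ∈-memᵇ v (V G) p | ∈-memᵇ v A (Equivalence.from (A-def v) (p , q))
                   | ∉-memᵇ v B q = refl

  no-two-teeth : ∀ e → Admissible G A e → ¬ (proj₁ e ∈ B × proj₂ e ∈ B)
  no-two-teeth e (inj₁ (e′ , e′∈ , eq)) (p , q) with ∈⇒index {G} e′∈
  ... | i , refl with eq
  ... | inj₁ (refl , refl) = B-stable i (p , q)
  ... | inj₂ (refl , refl) = B-stable i (q , p)
  no-two-teeth e (inj₂ (inj₁ (a , _))) (p , q) = proj₂ (Equivalence.to (A-def _) a) p
  no-two-teeth e (inj₂ (inj₂ (inj₁ (a , _)))) (p , q) = proj₂ (Equivalence.to (A-def _) a) q
  no-two-teeth e (inj₂ (inj₂ (inj₂ (a , _)))) (p , q) = a (B⊆V _ p)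

  teeth-per-edge : ∀ e → Admissible G A e → countL (λ b → inCutᵇ b e) B ≤ ⟦ touchesᵇ (innerᵇ G A) e ⟧
  teeth-per-edge (x , y) adm = begin
      countL (λ b → inCutᵇ b (x , y)) B
    ≤⟨ sumF-mono B (λ b _ → ⟦xor⟧≤⟦⟧+⟦⟧ (x ≡ᵇ b) (y ≡ᵇ b)) ⟩
      sumF (λ b → ⟦ x ≡ᵇ b ⟧ + ⟦ y ≡ᵇ b ⟧) B
    ≡⟨ sumF-+ _ _ B ⟩
      countL (x ≡ᵇ_) B + countL (y ≡ᵇ_) B
    ≡⟨ cong₂ _+_ (countL-≡ᵇ′ B B-unique x) (countL-≡ᵇ′ B B-unique y) ⟩
      ⟦ memᵇ x B ⟧ + ⟦ memᵇ y B ⟧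
    ≤⟨ ⟦⟧+⟦⟧≤⟦∨⟧ _ _ (λ (p , q) → no-two-teeth (x , y) adm (memᵇ-∈ x B p , memᵇ-∈ y B q)) ⟩
      ⟦ memᵇ x B ∨ memᵇ y B ⟧
    ≡⟨ cong ⟦_⟧ (sym (cong₂ _∨_ (inner≡tooth x) (inner≡tooth y))) ⟩
      ⟦ touchesᵇ (innerᵇ G A) (x , y) ⟧ ∎
    where open ≤-Reasoning

  star-lower-bound : ∀ N → All (Admissible G A) N →
    (∀ v → v ∈ V G → v ≢ r → oddᵇ (countL (inCutᵇ v) N) ≡ memᵇ v T) →
    count star ≤ countL (touchesᵇ (innerᵇ G A)) N
  star-lower-bound N adm par = begin
      count star
    ≡⟨ trans count-star (length≡countL-true B) ⟩
      countL (λ _ → true) B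
    ≤⟨ sumF-mono B (λ b b∈ → oddᵇ≡true⇒1≤ _
         (trans (par b (B⊆V b b∈) (λ { refl → r∉B b∈ })) (∈-memᵇ b T (B⊆T b b∈)))) ⟩
      sumF (λ b → countL (inCutᵇ b) N) B
    ≡⟨ sumF-swap (λ b e → ⟦ inCutᵇ b e ⟧) B N ⟩
      sumF (λ e → countL (λ b → inCutᵇ b e) B) N
    ≤⟨ sumF-mono N (λ e e∈ → teeth-per-edge e (All.lookup adm e∈)) ⟩
      countL (touchesᵇ (innerᵇ G A)) N ∎
    where open ≤-Reasoning

  rootedJoin : RootedJoin r A G T
  rootedJoin = record
    { wf = wf
    ; T⊆V = rake-T⊆V rake
    ; A⊆V = λ x x∈ → proj₁ (Equivalence.to (A-def x) x∈)
    ; r∈A = Equivalence.from (A-def r) (r∈V , r∉B)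
    ; F = star
    ; parity = parity-star
    ; reaches-root = star-reaches-root
    ; covers-root = star-covers-root
    ; lower-bound = star-lower-bound
    }

-- Gluing sums

module _ {X : Set} {P : X → Set} where

  sumAll : (∀ {x} → P x → ℕ) → ∀ {xs} → All P xs → ℕ
  sumAll g [] = 0
  sumAll g (p ∷ ps) = g p + sumAll g ps

  sumAll-zero : (g : ∀ {x} → P x → ℕ) → ∀ {xs} (ps : All P xs) →
    (∀ {x} (p : P x) → x ∈ xs → g p ≡ 0) → sumAll g ps ≡ 0
  sumAll-zero g [] h = refl
  sumAll-zero g (p ∷ ps) h rewrite h p (here refl) = sumAll-zero g ps (λ q x∈ → h q (there x∈))

  sumAll-single : (g : ∀ {x} → P x → ℕ) → ∀ {xs} (ps : All P xs) → Unique xs → ∀ {b} → b ∈ xs →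
    (∀ {x} (p : P x) → x ∈ xs → x ≢ b → g p ≡ 0) → Σ (P b) λ p → sumAll g ps ≡ g p
  sumAll-single g (p ∷ ps) (x∉ ∷ u) (here refl) h =
    p , trans (cong (g p +_) (sumAll-zero g ps (λ q c∈ → h q (there c∈) (λ { refl → All¬⇒¬Any x∉ c∈ }))))
              (+-identityʳ _)
  sumAll-single g (p ∷ ps) (x∉ ∷ u) (there b∈) h with sumAll-single g ps u b∈ (λ q c∈ → h q (there c∈))
  ... | q , eq = q , trans (cong (_+ sumAll g ps) (h p (here refl) (λ { refl → All¬⇒¬Any x∉ b∈ }))) eq

  sumAll+length≤sumF : (g : ∀ {x} → P x → ℕ) (k : X → ℕ) → ∀ {xs} (ps : All P xs) →
    (∀ {x} (p : P x) → x ∈ xs → suc (g p) ≤ k x) → sumAll g ps + length xs ≤ sumF k xs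
  sumAll+length≤sumF g k [] h = z≤n
  sumAll+length≤sumF g k {x ∷ xs} (p ∷ ps) h =
    subst (_≤ k x + sumF k xs) (sym (trans (+-suc (g p + sumAll g ps) (length xs)) (cong suc (+-assoc (g p) _ _))))
      (+-mono-≤ (h p (here refl)) (sumAll+length≤sumF g k ps (λ q x∈ → h q (there x∈))))

  concatAll : {Y : Set} → (∀ {x} → P x → List Y) → ∀ {xs} → All P xs → List Y
  concatAll ℓ [] = []
  concatAll ℓ (p ∷ ps) = ℓ p ++ concatAll ℓ ps

  countL-concatAll : {Y : Set} (ℓ : ∀ {x} → P x → List Y) (q : Y → Bool) → ∀ {xs} (ps : All P xs) →
    countL q (concatAll ℓ ps) ≡ sumAll (λ p → countL q (ℓ p)) ps
  countL-concatAll ℓ q [] = refl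
  countL-concatAll ℓ q (p ∷ ps) =
    trans (sumF-++ _ (ℓ p) (concatAll ℓ ps)) (cong (countL q (ℓ p) +_) (countL-concatAll ℓ q ps))

  length-concatAll : {Y : Set} (ℓ : ∀ {x} → P x → List Y) (k : ∀ {x} → P x → ℕ) →
    (∀ {x} (p : P x) → length (ℓ p) ≡ k p) → ∀ {xs} (ps : All P xs) → length (concatAll ℓ ps) ≡ sumAll k ps
  length-concatAll ℓ k h [] = refl
  length-concatAll ℓ k h (p ∷ ps) = trans (length-++ (ℓ p)) (cong₂ _+_ (h p) (length-concatAll ℓ k h ps))

  ∈-concatAll⁻ : {Y : Set} (ℓ : ∀ {x} → P x → List Y) → ∀ {xs} (ps : All P xs) → ∀ {y} → y ∈ concatAll ℓ ps →
    Σ X λ x → x ∈ xs × Σ (P x) λ p → y ∈ ℓ p × (∀ {y′} → y′ ∈ ℓ p → y′ ∈ concatAll ℓ ps)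
  ∈-concatAll⁻ ℓ (p ∷ ps) y∈ with ∈-++⁻ (ℓ p) y∈
  ... | inj₁ q = _ , here refl , p , q , ∈-++⁺ˡ
  ... | inj₂ q with ∈-concatAll⁻ ℓ ps q
  ... | x , x∈ , p′ , q′ , incl = x , there x∈ , p′ , q′ , ∈-++⁺ʳ (ℓ p) ∘ incl

  concatAll-⊆ : {Y : Set} (ℓ : ∀ {x} → P x → List Y) (m : X → List Y) →
    (∀ {x} (p : P x) → ℓ p ⊆ m x) → ∀ {xs} (ps : All P xs) → concatAll ℓ ps ⊆ concatMap m xs
  concatAll-⊆ ℓ m h [] = []
  concatAll-⊆ ℓ m h (p ∷ ps) = Sublist.++⁺ (h p) (concatAll-⊆ ℓ m h ps)

InE-ends : ∀ {K e} → WF K → InE (E K) e → proj₁ e ∈ V K × proj₂ e ∈ V K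
InE-ends {K} {x , y} w (e′ , e′∈ , inj₁ (refl , refl)) = proj₂ w e′ e′∈
InE-ends {K} {x , y} w (e′ , e′∈ , inj₂ (refl , refl)) = proj₂ (proj₂ w e′ e′∈) , proj₁ (proj₂ w e′ e′∈)

-- An admissible edge leaving V(K) meets V(K) in A, so it does not touch V(K) ∖ A.
cross+inner≤touches : ∀ {K A} → WF K → (∀ x → x ∈ A → x ∈ V K) → ∀ e → Admissible K A e →
  ⟦ crossᵇ (V K) e ⟧ + ⟦ touchesᵇ (innerᵇ K A) e ⟧ ≤ ⟦ touchesᵇ (λ v → memᵇ v (V K)) e ⟧
cross+inner≤touches {K} {A} w A⊆ (x , y) (inj₁ ie) with InE-ends w ie
... | xV , yV rewrite ∈-memᵇ x (V K) xV | ∈-memᵇ y (V K) yV = ⟦⟧≤1 _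
cross+inner≤touches {K} {A} w A⊆ (x , y) (inj₂ (inj₁ (xA , y∉)))
  rewrite ∈-memᵇ x (V K) (A⊆ x xA) | ∈-memᵇ x A xA | ∉-memᵇ y (V K) y∉ = s≤s z≤n
cross+inner≤touches {K} {A} w A⊆ (x , y) (inj₂ (inj₂ (inj₁ (yA , x∉))))
  rewrite ∈-memᵇ y (V K) (A⊆ y yA) | ∈-memᵇ y A yA | ∉-memᵇ x (V K) x∉ = s≤s z≤n
cross+inner≤touches {K} {A} w A⊆ (x , y) (inj₂ (inj₂ (inj₂ (x∉ , y∉))))
  rewrite ∉-memᵇ x (V K) x∉ | ∉-memᵇ y (V K) y∉ = z≤n

module Glue {G0 : Graph} {T0 : List ℕ} {r : ℕ} {B A : List ℕ}
  (rake : IsRake G0 T0 r B) (A-def : ∀ x → x ∈ A ⇔ (x ∈ V G0 × x ∉ B))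
  (H : ℕ → Graph) (TH AH : ℕ → List ℕ) (rH : ℕ → ℕ)
  (parts : ∀ b → b ∈ B → RootedJoin (rH b) (AH b) (H b) (TH b))
  (H∩G0 : ∀ b → b ∈ B → Disjoint (V (H b)) (V G0))
  (H∩H : ∀ b c → b ∈ B → c ∈ B → b ≢ c → Disjoint (V (H b)) (V (H c)))
  (f : EIdx G0 → ℕ)
  (f-into : ∀ i b → b ∈ B → inCutᵇ b (edge G0 i) ≡ true → f i ∈ AH b)
  (f-root : ∀ b → b ∈ B → Σ (EIdx G0) λ i → EdgeEq (edge G0 i) (r , b) × f i ≡ rH b)
  (G′ : Graph) (T′ : List ℕ) (wf′ : WF G′)
  (V-def : ∀ x → x ∈ V G′ ⇔ ((x ∈ V G0 × x ∉ B) ⊎ Σ ℕ λ b → b ∈ B × x ∈ V (H b)))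
  (E-def : SameEdges (E G′) (glueEdges G0 B H f))
  (T-def : ∀ x → x ∈ T′ ⇔ ((x ∈ T0 × x ∉ B) ⊎
            Σ ℕ λ b → b ∈ B × ((x ∈ TH b × x ≢ rH b) ⊎ (x ∉ TH b × x ≡ rH b))))
  where

  open IsRake rake

  Part : ℕ → Set
  Part b = RootedJoin (rH b) (AH b) (H b) (TH b)

  partEdges : ∀ {b} → Part b → List Edge
  partEdges {b} J = sel (E (H b)) (RootedJoin.F J)

  outside-G0 : ∀ {x c} → c ∈ B → x ∈ V (H c) → x ∉ V G0
  outside-G0 {x} {c} c∈ xH xG = H∩G0 c c∈ x xH xG

  same-part : ∀ {x c d} → c ∈ B → d ∈ B → x ∈ V (H c) → x ∈ V (H d) → c ≡ d
  same-part {x} {c} {d} c∈ d∈ p q with c ≟ d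
  ... | yes c≡d = c≡d
  ... | no c≢d = ⊥-elim (H∩H c d c∈ d∈ c≢d x p q)

  AH⊆VH : ∀ {c x} → c ∈ B → x ∈ AH c → x ∈ V (H c)
  AH⊆VH {c} {x} c∈ = RootedJoin.A⊆V (parts c c∈) x

  rH∈VH : ∀ {c} → c ∈ B → rH c ∈ V (H c)
  rH∈VH c∈ = AH⊆VH c∈ (RootedJoin.r∈A (parts _ c∈))

  TH⊆VH : ∀ {c x} → c ∈ B → x ∈ TH c → x ∈ V (H c)
  TH⊆VH {c} {x} c∈ = RootedJoin.T⊆V (parts c c∈) x

  A⊆V0 : ∀ {x} → x ∈ A → x ∈ V G0
  A⊆V0 {x} a = proj₁ (Equivalence.to (A-def x) a)

  part⊆V′ : ∀ {c v} → c ∈ B → v ∈ V (H c) → v ∈ V G′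
  part⊆V′ {c} {v} c∈ vH = Equivalence.from (V-def v) (inj₂ (c , c∈ , vH))

  part∌r : ∀ {c v} → c ∈ B → v ∈ V (H c) → v ≢ r
  part∌r c∈ vH refl = outside-G0 c∈ vH r∈V

  T′-outer : ∀ v → v ∈ V G0 → v ∉ B → memᵇ v T′ ≡ memᵇ v T0
  T′-outer v vG v∉B = memᵇ-cong (mk⇔ to (λ p → Equivalence.from (T-def v) (inj₁ (p , v∉B))))
    where
    to : v ∈ T′ → v ∈ T0
    to q with Equivalence.to (T-def v) q
    ... | inj₁ (p , _) = p
    ... | inj₂ (c , c∈ , inj₁ (t , _)) = ⊥-elim (outside-G0 c∈ (TH⊆VH c∈ t) vG)
    ... | inj₂ (c , c∈ , inj₂ (_ , refl)) = ⊥-elim (outside-G0 c∈ (rH∈VH c∈) vG)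

  T′-in-part : ∀ {b v} → b ∈ B → v ∈ V (H b) → v ∈ T′ → (v ∈ TH b × v ≢ rH b) ⊎ (v ∉ TH b × v ≡ rH b)
  T′-in-part {b} {v} b∈ vH q with Equivalence.to (T-def v) q
  ... | inj₁ (t , _) = ⊥-elim (outside-G0 b∈ vH (rake-T⊆V rake v t))
  ... | inj₂ (c , c∈ , inj₁ (t , ne)) with same-part c∈ b∈ (TH⊆VH c∈ t) vH
  ... | refl = inj₁ (t , ne)
  T′-in-part b∈ vH q | inj₂ (c , c∈ , inj₂ (nt , refl)) with same-part c∈ b∈ (rH∈VH c∈) vH
  ... | refl = inj₂ (nt , refl)

  T′-inner : ∀ b → b ∈ B → ∀ v → v ∈ V (H b) → memᵇ v T′ ≡ memᵇ v (TH b) xor (rH b ≡ᵇ v)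
  T′-inner b b∈ v vH with v ∈? TH b | rH b ≟ v
  ... | yes p | yes refl rewrite ∈-memᵇ v (TH b) p | ≡ᵇ-refl v =
    ∉-memᵇ v T′ (λ q → [ (λ (_ , v≢r) → v≢r refl) , (λ (v∉ , _) → v∉ p) ]′ (T′-in-part b∈ vH q))
  ... | yes p | no r≢v rewrite ∈-memᵇ v (TH b) p | ≡ᵇ-false (rH b) v r≢v =
    ∈-memᵇ v T′ (Equivalence.from (T-def v) (inj₂ (b , b∈ , inj₁ (p , r≢v ∘ sym))))
  ... | no p | yes refl rewrite ∉-memᵇ v (TH b) p | ≡ᵇ-refl v =
    ∈-memᵇ v T′ (Equivalence.from (T-def v) (inj₂ (b , b∈ , inj₂ (p , refl))))
  ... | no p | no r≢v rewrite ∉-memᵇ v (TH b) p | ≡ᵇ-false (rH b) v r≢v =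
    ∉-memᵇ v T′ (λ q → [ (λ (t , _) → p t) , (λ (_ , v≡r) → r≢v (sym v≡r)) ]′ (T′-in-part b∈ vH q))

  joins : All Part B
  joins = All.tabulate (λ {b} b∈ → parts b b∈)

  part-joins : List Edge
  part-joins = concatAll partEdges joins

  crossesB : EIdx G0 → Bool
  crossesB i = cutBᵇ B (edge G0 i)

  rerouted : EIdx G0 → Edge
  rerouted i = outer B (edge G0 i) , f i

  crossing : List (EIdx G0)
  crossing = filterᵇ crossesB (allFin _)

  RootSpoke : EIdx G0 → ℕ → Set
  RootSpoke i b = b ∈ B × EdgeEq (edge G0 i) (r , b) × f i ≡ rH b

  open Witnesses RootSpoke

  root-spokes : All (λ b → Σ (EIdx G0) λ i → RootSpoke i b) B
  root-spokes = All.tabulate (λ {b} b∈ → proj₁ (f-root b b∈) , b∈ , proj₂ (f-root b b∈))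

  C : List (EIdx G0)
  C = witnesses root-spokes

  C-unique : Unique C
  C-unique = witnesses-unique root-spokes B-unique
    (λ i b c p q → star-tooth-unique r∉B (proj₁ p) (proj₁ (proj₂ p)) (proj₁ (proj₂ q)))

  spoke-crosses : ∀ e {b} → b ∈ B → EdgeEq e (r , b) → outer B e ≡ r × cutBᵇ B e ≡ true
  spoke-crosses (x , y) {b} b∈ (inj₁ (refl , refl)) rewrite ∉-memᵇ r B r∉B | ∈-memᵇ b B b∈ = refl , refl
  spoke-crosses (x , y) {b} b∈ (inj₂ (refl , refl)) rewrite ∉-memᵇ r B r∉B | ∈-memᵇ b B b∈ = refl , refl

  rerouted-spoke : ∀ i b → RootSpoke i b → rerouted i ≡ (r , rH b) × crossesB i ≡ true
  rerouted-spoke i b (b∈ , eq , fi) = cong₂ _,_ (proj₁ crosses) fi , proj₂ crosses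
    where crosses = spoke-crosses (edge G0 i) b∈ eq

  -- The edges r r_b of the gluing sum: the images of the spokes r b of the rake.
  star-edges : List Edge
  star-edges = map rerouted (filterᵇ (λ i → memF i C) crossing)

  star-edges⊆ : star-edges ⊆ map rerouted crossing
  star-edges⊆ = Sublist.map⁺ rerouted (Sublist.filter-⊆ (T? ∘ (λ i → memF i C)) crossing)

  countL-star-edges : ∀ q → countL q star-edges ≡ countL (λ b → q (r , rH b)) B
  countL-star-edges q = begin
      countL q star-edges
    ≡⟨ sumF-map (λ e → ⟦ q e ⟧) rerouted (filterᵇ (λ i → memF i C) crossing) ⟩
      countL (q ∘ rerouted) (filterᵇ (λ i → memF i C) crossing)
    ≡⟨ countL-filterᵇ (λ i → memF i C) (q ∘ rerouted) crossing ⟩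
      countL (λ i → memF i C ∧ q (rerouted i)) crossing
    ≡⟨ countL-filterᵇ crossesB _ (allFin _) ⟩
      countL (λ i → crossesB i ∧ (memF i C ∧ q (rerouted i))) (allFin _)
    ≡⟨ sym (count≡countL-allFin (λ i → crossesB i ∧ (memF i C ∧ q (rerouted i)))) ⟩
      count (λ i → crossesB i ∧ (memF i C ∧ q (rerouted i)))
    ≡⟨ count-cong spokes-cross ⟩
      count (λ i → memF i C ∧ q (rerouted i))
    ≡⟨ count-memF C C-unique (q ∘ rerouted) ⟩
      countL (q ∘ rerouted) C
    ≡⟨ countL-witnesses root-spokes _ _ (λ i b s → cong q (proj₁ (rerouted-spoke i b s))) ⟩
      countL (λ b → q (r , rH b)) B ∎
    where
    open ≡-Reasoning
    spokes-cross : ∀ i → crossesB i ∧ (memF i C ∧ q (rerouted i)) ≡ memF i C ∧ q (rerouted i)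
    spokes-cross i with memF i C in i∈C
    ... | false = ∧-zeroʳ (crossesB i)
    ... | true with ∈-witnesses⁻ root-spokes i (memF-∈ i C i∈C)
    ... | b , _ , s rewrite proj₂ (rerouted-spoke i b s) = refl

  ∈-star-edges⁻ : ∀ e → e ∈ star-edges → Σ ℕ λ b → b ∈ B × e ≡ (r , rH b)
  ∈-star-edges⁻ e e∈ with ∈-map⁻ rerouted e∈
  ... | i , i∈ , refl with ∈-filter⁻ (T? ∘ (λ i → memF i C)) {xs = crossing} i∈
  ... | _ , i∈C with ∈-witnesses⁻ root-spokes i (memF-∈ i C (Equivalence.to T-≡ i∈C))
  ... | b , _ , s = b , proj₁ s , proj₁ (rerouted-spoke i b s)

  ∈-star-edges⁺ : ∀ b → b ∈ B → (r , rH b) ∈ star-edges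
  ∈-star-edges⁺ b b∈ with ∈-witnesses⁺ root-spokes b b∈
  ... | j , j∈ , s = subst (_∈ star-edges) (proj₁ (rerouted-spoke j b s))
    (∈-map⁺ rerouted (∈-filter⁺ (T? ∘ (λ i → memF i C))
      (∈-filter⁺ (T? ∘ crossesB) (∈-allFin j) (Equivalence.from T-≡ (proj₂ (rerouted-spoke j b s))))
      (Equivalence.from T-≡ (∈-memF j C j∈))))

  join-edges : List Edge
  join-edges = part-joins ++ star-edges

  Eg : List Edge
  Eg = glueEdges G0 B H f

  join-edges⊆ : join-edges ⊆ Eg
  join-edges⊆ = Sublist.++⁺ˡ (map (edge G0) (filterᵇ (λ i → not (crossesB i)) (allFin _))) (Sublist.++⁺ (concatAll-⊆ partEdges (λ b → E (H b)) (λ {b} J → sel-sublist (E (H b)) (RootedJoin.F J)) joins)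
                                            star-edges⊆)

  π : Fin (length (E G′)) ↔ Fin (length Eg)
  π = proj₁ E-def

  F′ : EdgeSet G′
  F′ i = selector join-edges⊆ (Inverse.to π i)

  deg-F′ : ∀ v → deg G′ F′ v ≡ countL (inCutᵇ v) join-edges
  deg-F′ v =
    trans (count-cong (λ i → cong (F′ i ∧_) (inCutᵇ-resp-EdgeEq v (proj₂ E-def i))))
    (trans (count-permute π (λ j → selector join-edges⊆ j ∧ inCutᵇ v (lookup Eg j)))
    (trans (countL-sel Eg (selector join-edges⊆) (inCutᵇ v)) (cong (countL (inCutᵇ v)) (sel-selector join-edges⊆))))

  count-F′ : count F′ ≡ length join-edges
  count-F′ = trans (count-permute π (selector join-edges⊆))
    (trans (count≡length-sel Eg (selector join-edges⊆)) (cong length (sel-selector join-edges⊆)))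

  selected-F′ : ∀ e → e ∈ join-edges → Σ (EIdx G′) λ i → F′ i ≡ true × EdgeEq (edge G′ i) e
  selected-F′ e e∈ with ∈-sel⁻ Eg (selector join-edges⊆) e (subst (e ∈_) (sym (sel-selector join-edges⊆)) e∈)
  ... | j , Fj , refl = i , subst (λ k → selector join-edges⊆ k ≡ true) (sym to-i) Fj ,
                        subst (λ k → EdgeEq (edge G′ i) (lookup Eg k)) to-i (proj₂ E-def i)
    where
    i = Inverse.from π j
    to-i : Inverse.to π i ≡ j
    to-i = Inverse.strictlyInverseˡ π j

  covers-F′⇒ : ∀ u → Covers G′ F′ u → CoversL join-edges u
  covers-F′⇒ u (i , Fi , en) =
    lookup Eg (Inverse.to π i) ,
    subst (lookup Eg (Inverse.to π i) ∈_) (sel-selector join-edges⊆) (∈-sel⁺ Eg (selector join-edges⊆) (Inverse.to π i) Fi) ,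
    Ends-resp-EdgeEq (proj₂ E-def i) en

  ⇒covers-F′ : ∀ u → CoversL join-edges u → Covers G′ F′ u
  ⇒covers-F′ u (e , e∈ , en) with selected-F′ e e∈
  ... | i , Fi , eq = i , Fi , Ends-resp-EdgeEq (EdgeEq-sym eq) en

  InNoPart : ℕ → Set
  InNoPart x = ∀ c → c ∈ B → x ∉ V (H c)

  V0⇒InNoPart : ∀ {x} → x ∈ V G0 → InNoPart x
  V0⇒InNoPart xG c c∈ xH = outside-G0 c∈ xH xG

  ∉V′⇒InNoPart : ∀ {x} → x ∉ V G′ → InNoPart x
  ∉V′⇒InNoPart x∉ c c∈ xH = x∉ (part⊆V′ c∈ xH)

  data EdgeKind (e : Edge) : Set where
    outside : InNoPart (proj₁ e) → InNoPart (proj₂ e) → EdgeKind e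
    inside : ∀ c → c ∈ B → InE (E (H c)) e → EdgeKind e
    attached₁ : ∀ c → c ∈ B → proj₁ e ∈ AH c → InNoPart (proj₂ e) → EdgeKind e
    attached₂ : ∀ c → c ∈ B → proj₂ e ∈ AH c → InNoPart (proj₁ e) → EdgeKind e

  EdgeKind-resp : ∀ {e g} → EdgeEq e g → EdgeKind g → EdgeKind e
  EdgeKind-resp {a , b} {c , d} (inj₁ (refl , refl)) k = k
  EdgeKind-resp {a , b} {c , d} (inj₂ (refl , refl)) (outside n₁ n₂) = outside n₂ n₁
  EdgeKind-resp {a , b} {c , d} (inj₂ (refl , refl)) (inside p p∈ (e′ , e′∈ , eq)) =
    inside p p∈ (e′ , e′∈ , EdgeEq-trans (inj₂ (refl , refl)) eq)
  EdgeKind-resp {a , b} {c , d} (inj₂ (refl , refl)) (attached₁ p p∈ x n) = attached₂ p p∈ x n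
  EdgeKind-resp {a , b} {c , d} (inj₂ (refl , refl)) (attached₂ p p∈ x n) = attached₁ p p∈ x n

  kind-rerouted : ∀ e y → proj₁ e ∈ V G0 → proj₂ e ∈ V G0 → cutBᵇ B e ≡ true →
    (∀ c → c ∈ B → inCutᵇ c e ≡ true → y ∈ AH c) → EdgeKind (outer B e , y)
  kind-rerouted (a , b) y aG bG cut into with memᵇ a B in a-B | memᵇ b B in b-B
  kind-rerouted (a , b) y aG bG () into | true | true
  kind-rerouted (a , b) y aG bG () into | false | false
  ... | true | false = attached₂ a a∈ (into a a∈ a-cut) (V0⇒InNoPart bG)
    where
    a∈ = memᵇ-∈ a B a-B
    a-cut : inCutᵇ a (a , b) ≡ true
    a-cut rewrite ≡ᵇ-refl a | ≡ᵇ-false b a (λ { refl → memᵇ-∉ b B b-B a∈ }) = refl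
  ... | false | true = attached₂ b b∈ (into b b∈ b-cut) (V0⇒InNoPart aG)
    where
    b∈ = memᵇ-∈ b B b-B
    b-cut : inCutᵇ b (a , b) ≡ true
    b-cut rewrite ≡ᵇ-refl b | ≡ᵇ-false a b (λ { refl → memᵇ-∉ a B a-B b∈ }) = refl

  kind-glued : ∀ g → g ∈ Eg → EdgeKind g
  kind-glued g g∈ with ∈-++⁻ (map (edge G0) (filterᵇ (λ i → not (crossesB i)) (allFin _))) g∈
  ... | inj₁ p with ∈-map⁻ (edge G0) p
  ... | i , _ , refl = outside (V0⇒InNoPart (proj₁ ends)) (V0⇒InNoPart (proj₂ ends))
    where ends = proj₂ wf (edge G0 i) (∈-lookup i)
  kind-glued g g∈ | inj₂ p with ∈-++⁻ (concatMap (λ b → E (H b)) B) p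
  ... | inj₁ p′ with find (∈-concatMap⁻ (λ b → E (H b)) {xs = B} p′)
  ... | c , c∈ , g∈H = inside c c∈ (g , g∈H , EdgeEq-refl g)
  kind-glued g g∈ | inj₂ p | inj₂ p′ with ∈-map⁻ rerouted p′
  ... | i , i∈ , refl =
    kind-rerouted (edge G0 i) (f i) (proj₁ ends) (proj₂ ends)
      (Equivalence.to T-≡ (proj₂ (∈-filter⁻ (T? ∘ crossesB) {xs = allFin _} i∈))) (f-into i)
    where ends = proj₂ wf (edge G0 i) (∈-lookup i)

  kind-admissible : ∀ e → Admissible G′ A e → EdgeKind e
  kind-admissible e (inj₁ (e′ , e′∈ , eq)) with ∈⇒index {G′} e′∈
  ... | i , refl = EdgeKind-resp (EdgeEq-trans eq (proj₂ E-def i)) (kind-glued _ (∈-lookup (Inverse.to π i)))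
  kind-admissible e (inj₂ (inj₁ (xA , y∉))) = outside (V0⇒InNoPart (A⊆V0 xA)) (∉V′⇒InNoPart y∉)
  kind-admissible e (inj₂ (inj₂ (inj₁ (yA , x∉)))) = outside (∉V′⇒InNoPart x∉) (V0⇒InNoPart (A⊆V0 yA))
  kind-admissible e (inj₂ (inj₂ (inj₂ (x∉ , y∉)))) = outside (∉V′⇒InNoPart x∉) (∉V′⇒InNoPart y∉)

  admissible-in-part : ∀ {b e} → b ∈ B → EdgeKind e → Admissible (H b) (AH b) e
  admissible-in-part {b} b∈ (outside n₁ n₂) = inj₂ (inj₂ (inj₂ (n₁ b b∈ , n₂ b b∈)))
  admissible-in-part {b} b∈ (inside c c∈ ie) with c ≟ b
  ... | yes refl = inj₁ ie
  ... | no c≢b = inj₂ (inj₂ (inj₂ (H∩H c b c∈ b∈ c≢b _ (proj₁ ends) , H∩H c b c∈ b∈ c≢b _ (proj₂ ends))))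
    where ends = InE-ends (RootedJoin.wf (parts c c∈)) ie
  admissible-in-part {b} b∈ (attached₁ c c∈ xA n) with c ≟ b
  ... | yes refl = inj₂ (inj₁ (xA , n b b∈))
  ... | no c≢b = inj₂ (inj₂ (inj₂ (H∩H c b c∈ b∈ c≢b _ (AH⊆VH c∈ xA) , n b b∈)))
  admissible-in-part {b} b∈ (attached₂ c c∈ yA n) with c ≟ b
  ... | yes refl = inj₂ (inj₂ (inj₁ (yA , n b b∈)))
  ... | no c≢b = inj₂ (inj₂ (inj₂ (n b b∈ , H∩H c b c∈ b∈ c≢b _ (AH⊆VH c∈ yA))))

  inPartᵇ : ℕ → ℕ → Bool
  inPartᵇ b v = memᵇ v (V (H b))

  part⊆inner : ∀ {x c} → c ∈ B → x ∈ V (H c) → innerᵇ G′ A x ≡ true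
  part⊆inner {x} c∈ xH rewrite ∈-memᵇ x (V G′) (part⊆V′ c∈ xH) | ∉-memᵇ x A (outside-G0 c∈ xH ∘ A⊆V0) = refl

  not-in-other-part : ∀ {c x} → c ∈ B → x ∈ V (H c) → ∀ b → b ∈ B → b ≢ c → inPartᵇ b x ≡ false
  not-in-other-part {c} {x} c∈ xH b b∈ b≢c = ∉-memᵇ x _ (H∩H c b c∈ b∈ (b≢c ∘ sym) x xH)

  touches-single-part : ∀ e {c} → c ∈ B → (proj₁ e ∈ V (H c) ⊎ proj₂ e ∈ V (H c)) →
    (∀ b → b ∈ B → b ≢ c → touchesᵇ (inPartᵇ b) e ≡ false) →
    countL (λ b → touchesᵇ (inPartᵇ b) e) B ≤ ⟦ touchesᵇ (innerᵇ G′ A) e ⟧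
  touches-single-part (x , y) {c} c∈ side others = begin
      countL (λ b → touchesᵇ (inPartᵇ b) (x , y)) B
    ≡⟨ sumF-single _ B B-unique c∈ (λ b b∈ b≢c → cong ⟦_⟧ (others b b∈ b≢c)) ⟩
      ⟦ touchesᵇ (inPartᵇ c) (x , y) ⟧
    ≤⟨ ⟦⟧≤1 _ ⟩
      1
    ≡⟨ cong ⟦_⟧ (sym (touches-inner side)) ⟩
      ⟦ touchesᵇ (innerᵇ G′ A) (x , y) ⟧ ∎
    where
    open ≤-Reasoning
    touches-inner : x ∈ V (H c) ⊎ y ∈ V (H c) → touchesᵇ (innerᵇ G′ A) (x , y) ≡ true
    touches-inner (inj₁ xH) rewrite part⊆inner c∈ xH = refl
    touches-inner (inj₂ yH) rewrite part⊆inner c∈ yH = ∨-zeroʳ _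

  -- The parts V(H_b) are disjoint and contained in V(G′) ∖ A.
  parts-touched≤ : ∀ e → EdgeKind e → countL (λ b → touchesᵇ (inPartᵇ b) e) B ≤ ⟦ touchesᵇ (innerᵇ G′ A) e ⟧
  parts-touched≤ e (outside n₁ n₂) = subst (_≤ _)
    (sym (countL-zero _ B (λ b b∈ → cong₂ _∨_ (∉-memᵇ _ _ (n₁ b b∈)) (∉-memᵇ _ _ (n₂ b b∈))))) z≤n
  parts-touched≤ e (inside c c∈ ie) = touches-single-part e c∈ (inj₁ (proj₁ ends)) (λ b b∈ b≢c →
      cong₂ _∨_ (not-in-other-part c∈ (proj₁ ends) b b∈ b≢c) (not-in-other-part c∈ (proj₂ ends) b b∈ b≢c))
    where ends = InE-ends (RootedJoin.wf (parts c c∈)) ie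
  parts-touched≤ e (attached₁ c c∈ xA n) = touches-single-part e c∈ (inj₁ (AH⊆VH c∈ xA)) (λ b b∈ b≢c →
      cong₂ _∨_ (not-in-other-part c∈ (AH⊆VH c∈ xA) b b∈ b≢c) (∉-memᵇ _ _ (n b b∈)))
  parts-touched≤ e (attached₂ c c∈ yA n) = touches-single-part e c∈ (inj₂ (AH⊆VH c∈ yA)) (λ b b∈ b≢c →
      cong₂ _∨_ (∉-memᵇ _ _ (n b b∈)) (not-in-other-part c∈ (AH⊆VH c∈ yA) b b∈ b≢c))

  deg-join-edges : ∀ v → countL (inCutᵇ v) join-edges ≡
    sumAll (λ J → countL (inCutᵇ v) (partEdges J)) joins + countL (λ b → inCutᵇ v (r , rH b)) B
  deg-join-edges v = trans (sumF-++ _ part-joins star-edges)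
    (cong₂ _+_ (countL-concatAll partEdges (inCutᵇ v) joins) (countL-star-edges (inCutᵇ v)))

  partEdges-avoid : ∀ {c} (J : Part c) v → v ∉ V (H c) → countL (inCutᵇ v) (partEdges J) ≡ 0
  partEdges-avoid {c} J v v∉ = countL-zero _ (partEdges J) (λ e e∈ → inCutᵇ-avoid v e
    (λ { refl → v∉ (proj₁ (ends e e∈)) }) (λ { refl → v∉ (proj₂ (ends e e∈)) }))
    where ends = sel-ends {H c} {RootedJoin.F J} (RootedJoin.wf J)

  parity-outer : ∀ v → v ∈ V G0 → v ∉ B → oddᵇ (deg G′ F′ v) ≡ memᵇ v T′
  parity-outer v vG v∉B = begin
      oddᵇ (deg G′ F′ v)
    ≡⟨ cong oddᵇ (trans (deg-F′ v) (deg-join-edges v)) ⟩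
      oddᵇ (sumAll (λ J → countL (inCutᵇ v) (partEdges J)) joins + countL (λ b → inCutᵇ v (r , rH b)) B)
    ≡⟨ cong (λ k → oddᵇ (k + countL (λ b → inCutᵇ v (r , rH b)) B))
            (sumAll-zero _ joins (λ J c∈ → partEdges-avoid J v (λ vH → outside-G0 c∈ vH vG))) ⟩
      oddᵇ (countL (λ b → inCutᵇ v (r , rH b)) B)
    ≡⟨ cong oddᵇ (sumF-cong B (λ b b∈ → cong ⟦_⟧ (trans
         (cong ((r ≡ᵇ v) xor_) (≡ᵇ-false (rH b) v (λ { refl → outside-G0 b∈ (rH∈VH b∈) vG })))
         (xor-identityʳ (r ≡ᵇ v))))) ⟩
      oddᵇ (countL (λ _ → r ≡ᵇ v) B)
    ≡⟨ oddᵇ-countL-const (r ≡ᵇ v) B ⟩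
      (r ≡ᵇ v) ∧ oddᵇ (length B)
    ≡⟨ cong (_∨ ((r ≡ᵇ v) ∧ oddᵇ (length B))) (sym (∉-memᵇ v B v∉B)) ⟩
      memᵇ v B ∨ ((r ≡ᵇ v) ∧ oddᵇ (length B))
    ≡⟨ sym (rake-memᵇ-T rake v) ⟩
      memᵇ v T0
    ≡⟨ sym (T′-outer v vG v∉B) ⟩
      memᵇ v T′ ∎
    where open ≡-Reasoning

  parity-inner : ∀ b → b ∈ B → ∀ v → v ∈ V (H b) → oddᵇ (deg G′ F′ v) ≡ memᵇ v T′
  parity-inner b b∈ v vH with sumAll-single (λ J → countL (inCutᵇ v) (partEdges J)) joins B-unique b∈
                                (λ J c∈ c≢b → partEdges-avoid J v (λ vc → c≢b (same-part c∈ b∈ vc vH)))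
  ... | J , only-J = begin
      oddᵇ (deg G′ F′ v)
    ≡⟨ cong oddᵇ (trans (deg-F′ v) (deg-join-edges v)) ⟩
      oddᵇ (sumAll (λ J → countL (inCutᵇ v) (partEdges J)) joins + countL (λ c → inCutᵇ v (r , rH c)) B)
    ≡⟨ cong₂ (λ k l → oddᵇ (k + l)) only-J star-part ⟩
      oddᵇ (countL (inCutᵇ v) (partEdges J) + ⟦ rH b ≡ᵇ v ⟧)
    ≡⟨ oddᵇ-+ (countL (inCutᵇ v) (partEdges J)) _ ⟩
      oddᵇ (countL (inCutᵇ v) (partEdges J)) xor oddᵇ ⟦ rH b ≡ᵇ v ⟧
    ≡⟨ cong₂ _xor_ (trans (cong oddᵇ (sym (deg≡countL-sel {H b} {RootedJoin.F J} v))) (RootedJoin.parity J v vH))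
                   (oddᵇ-⟦⟧ _) ⟩
      memᵇ v (TH b) xor (rH b ≡ᵇ v)
    ≡⟨ sym (T′-inner b b∈ v vH) ⟩
      memᵇ v T′ ∎
    where
    open ≡-Reasoning
    star-part : countL (λ c → inCutᵇ v (r , rH c)) B ≡ ⟦ rH b ≡ᵇ v ⟧
    star-part = trans (sumF-cong B (λ c _ → cong (λ z → ⟦ z xor (rH c ≡ᵇ v) ⟧) (≡ᵇ-false r v (part∌r b∈ vH ∘ sym))))
      (sumF-single (λ c → ⟦ rH c ≡ᵇ v ⟧) B B-unique b∈
        (λ c c∈ c≢b → cong ⟦_⟧ (≡ᵇ-false (rH c) v (λ { refl → c≢b (same-part c∈ b∈ (rH∈VH c∈) vH) }))))

  parity-F′ : ∀ v → v ∈ V G′ → oddᵇ (deg G′ F′ v) ≡ memᵇ v T′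
  parity-F′ v v∈ with Equivalence.to (V-def v) v∈
  ... | inj₁ (vG , v∉B) = parity-outer v vG v∉B
  ... | inj₂ (b , b∈ , vH) = parity-inner b b∈ v vH

  join-edges-reach-root : ∀ u → CoversL join-edges u → ReachL join-edges u r
  join-edges-reach-root u (e , e∈ , en) with ∈-++⁻ part-joins e∈
  ... | inj₂ p with ∈-star-edges⁻ e p
  ... | b , b∈ , refl with en
  ... | inj₁ refl = here
  ... | inj₂ refl = step (r , rH b) e∈ (inj₂ (refl , refl)) here
  join-edges-reach-root u (e , e∈ , en) | inj₁ p with ∈-concatAll⁻ partEdges joins p
  ... | b , b∈ , J , e∈J , incl =
    ReachL-trans
      (ReachL-⊆ (λ e′ q → ∈-++⁺ˡ (incl q))
        (Reach⇒ReachL {H b} {RootedJoin.F J} (RootedJoin.reaches-root J u (CoversL⇒Covers {H b} {RootedJoin.F J} (e , e∈J , en)))))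
      (step (r , rH b) (∈-++⁺ʳ part-joins (∈-star-edges⁺ b b∈)) (inj₂ (refl , refl)) here)

  covers-root-F′ : Covers G′ F′ r
  covers-root-F′ with N-B r r∈V r∉B
  ... | b , b∈ , _ = ⇒covers-F′ r ((r , rH b) , ∈-++⁺ʳ part-joins (∈-star-edges⁺ b b∈) , inj₁ refl)

  length-join-edges : length join-edges ≡ sumAll (λ J → count (RootedJoin.F J)) joins + length B
  length-join-edges = trans (length-++ part-joins) (cong₂ _+_
    (length-concatAll partEdges (λ J → count (RootedJoin.F J))
      (λ {b} J → sym (count≡length-sel (E (H b)) (RootedJoin.F J))) joins)
    (trans (length≡countL-true star-edges) (trans (countL-star-edges (λ _ → true)) (sym (length≡countL-true B)))))

  module _ (N : List Edge) (adm : All (Admissible G′ A) N)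
    (par : ∀ v → v ∈ V G′ → v ≢ r → oddᵇ (countL (inCutᵇ v) N) ≡ memᵇ v T′) where

    -- T′ ∩ V(H_c) = T_c Δ {r_c} has odd size, so some edge of N leaves V(H_c).
    leaves-part : ∀ {c} (J : Part c) → c ∈ B → 1 ≤ countL (crossᵇ (V (H c))) N
    leaves-part {c} J c∈ = oddᵇ≡true⇒1≤ _ (begin
        oddᵇ (countL (crossᵇ (V (H c))) N)
      ≡⟨ sym (handshake (V (H c)) (proj₁ (RootedJoin.wf J)) N) ⟩
        oddᵇ (sumF (λ v → countL (inCutᵇ v) N) (V (H c)))
      ≡⟨ oddᵇ-sumF-cong (V (H c)) (λ v vH → trans (par v (part⊆V′ c∈ vH) (part∌r c∈ vH))
                                             (trans (T′-inner c c∈ v vH) (sym (oddᵇ-⟦⟧ _)))) ⟩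
        oddᵇ (countL (λ v → memᵇ v (TH c) xor (rH c ≡ᵇ v)) (V (H c)))
      ≡⟨ oddᵇ-countL-xor (λ v → memᵇ v (TH c)) (rH c ≡ᵇ_) (V (H c)) ⟩
        oddᵇ (countL (λ v → memᵇ v (TH c)) (V (H c))) xor oddᵇ (countL (rH c ≡ᵇ_) (V (H c)))
      ≡⟨ cong₂ _xor_ (join⇒even-T {H c} {TH c} {RootedJoin.F J} (RootedJoin.wf J) (RootedJoin.parity J))
                     (trans (oddᵇ-countL-≡ᵇ′ (V (H c)) (proj₁ (RootedJoin.wf J)) (rH c)) (∈-memᵇ _ _ (rH∈VH c∈))) ⟩
        true ∎)
      where open ≡-Reasoning

    part-bound : ∀ {c} (J : Part c) → c ∈ B → suc (count (RootedJoin.F J)) ≤ countL (touchesᵇ (inPartᵇ c)) N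
    part-bound {c} J c∈ = begin
        suc (count (RootedJoin.F J))
      ≤⟨ +-mono-≤ (leaves-part J c∈) (RootedJoin.lower-bound J N adm-c par-c) ⟩
        countL (crossᵇ (V (H c))) N + countL (touchesᵇ (innerᵇ (H c) (AH c))) N
      ≡⟨ sym (sumF-+ (λ e → ⟦ crossᵇ (V (H c)) e ⟧) (λ e → ⟦ touchesᵇ (innerᵇ (H c) (AH c)) e ⟧) N) ⟩
        sumF (λ e → ⟦ crossᵇ (V (H c)) e ⟧ + ⟦ touchesᵇ (innerᵇ (H c) (AH c)) e ⟧) N
      ≤⟨ sumF-mono N (λ e e∈ → cross+inner≤touches (RootedJoin.wf J) (RootedJoin.A⊆V J) e (All.lookup adm-c e∈)) ⟩
        countL (touchesᵇ (inPartᵇ c)) N ∎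
      where
      open ≤-Reasoning
      adm-c : All (Admissible (H c) (AH c)) N
      adm-c = All.map (λ {e} a → admissible-in-part c∈ (kind-admissible e a)) adm
      par-c : ∀ v → v ∈ V (H c) → v ≢ rH c → oddᵇ (countL (inCutᵇ v) N) ≡ memᵇ v (TH c)
      par-c v vH v≢rc = trans (par v (part⊆V′ c∈ vH) (part∌r c∈ vH))
        (trans (T′-inner c c∈ v vH) (trans (cong (memᵇ v (TH c) xor_) (≡ᵇ-false (rH c) v (v≢rc ∘ sym)))
                                           (xor-identityʳ _)))

    lower-bound-F′ : count F′ ≤ countL (touchesᵇ (innerᵇ G′ A)) N
    lower-bound-F′ = begin
        count F′
      ≡⟨ trans count-F′ length-join-edges ⟩
        sumAll (λ J → count (RootedJoin.F J)) joins + length B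
      ≤⟨ sumAll+length≤sumF _ (λ b → countL (touchesᵇ (inPartᵇ b)) N) joins part-bound ⟩
        sumF (λ b → countL (touchesᵇ (inPartᵇ b)) N) B
      ≡⟨ sumF-swap (λ b e → ⟦ touchesᵇ (inPartᵇ b) e ⟧) B N ⟩
        sumF (λ e → countL (λ b → touchesᵇ (inPartᵇ b) e) B) N
      ≤⟨ sumF-mono N (λ e e∈ → parts-touched≤ e (kind-admissible e (All.lookup adm e∈))) ⟩
        countL (touchesᵇ (innerᵇ G′ A)) N ∎
      where open ≤-Reasoning

  T′⊆V′ : ∀ t → t ∈ T′ → t ∈ V G′
  T′⊆V′ t t∈ with Equivalence.to (T-def t) t∈
  ... | inj₁ (t∈T0 , t∉B) = Equivalence.from (V-def t) (inj₁ (rake-T⊆V rake t t∈T0 , t∉B))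
  ... | inj₂ (c , c∈ , inj₁ (t∈TH , _)) = part⊆V′ c∈ (TH⊆VH c∈ t∈TH)
  ... | inj₂ (c , c∈ , inj₂ (_ , refl)) = part⊆V′ c∈ (rH∈VH c∈)

  rootedJoin : RootedJoin r A G′ T′
  rootedJoin = record
    { wf = wf′
    ; T⊆V = T′⊆V′
    ; A⊆V = λ x a → Equivalence.from (V-def x) (inj₁ (Equivalence.to (A-def x) a))
    ; r∈A = Equivalence.from (A-def r) (r∈V , r∉B)
    ; F = F′
    ; parity = parity-F′
    ; reaches-root = λ u c → ReachL⇒Reach {G′} {F′} selected-F′ (join-edges-reach-root u (covers-F′⇒ u c))
    ; covers-root = covers-root-F′
    ; lower-bound = lower-bound-F′
    }

P⇒RootedJoin : ∀ {r A G T} → P r A G T → RootedJoin r A G T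
P⇒RootedJoin (rake isRake A-def) = Rake.rootedJoin isRake A-def
P⇒RootedJoin (glue isRake A-def H TH AH rH parts H∩G0 H∩H f f-into f-root G′ T′ wf′ V-def E-def T-def) =
  Glue.rootedJoin isRake A-def H TH AH rH (λ b b∈ → P⇒RootedJoin (parts b b∈))
    H∩G0 H∩H f f-into f-root G′ T′ wf′ V-def E-def T-def

lemma5p7 : ∀ {r : ℕ} {A : List ℕ} {G : Graph} {T : List ℕ} →
    P r A G T →
    (H : Graph) → IsGraft H [] → Disjoint (V G) (V H) →
    (S : List Edge) →
    (∀ e → e ∈ S → (proj₁ e ∈ A × proj₂ e ∈ V H) ⊎ (proj₂ e ∈ A × proj₁ e ∈ V H)) →
    IsGraft (G ⊕ H ⊕ S) T ×
    Σ (EdgeSet (G ⊕ H ⊕ S)) λ F →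
      IsMinJoin (G ⊕ H ⊕ S) T F × IsConnected (G ⊕ H ⊕ S) F × Covers (G ⊕ H ⊕ S) F r
lemma5p7 p H graftH disjoint S S-between = isGraft , FK , (isJoin , isMinimal) , isConnected , covers-r
  where open Extension (P⇒RootedJoin p) H graftH disjoint S S-between
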